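{- For every integer $t\geq 4$, every graph that does not contain $K_t$ as a minor has a colouring with $2t-2$ colours such that for $t-1$ of the colours each monochromatic component has at most $t-4$ vertices, and for the other $t-1$ colours each monochromatic component is a path.
   Context: All graphs are finite and simple. Colourings need not be proper; a monochromatic component is a connected component of the subgraph induced by the vertices of one colour. -}

module Defs where

open import Data.Nat using (ℕ; _≤_; _+_)
open import Data.Fin using (Fin; toℕ)
open import Data.Bool using (Bool; true; false)
open import Data.Maybe using (Maybe; just)
open import Data.Product using (Σ; ∃; ∃₂; _×_)
open import Data.Sum using (_⊎_)
open import Data.List using (List; length; lookup)
open import Data.List.Relation.Unary.All using (All)
open import Data.List.Relation.Unary.Unique.Propositional using (Unique)
open import Data.List.Membership.Propositional using (_∈_)
open import Relation.Binary.PropositionalEquality using (_≡_; _≢_)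
open import Relation.Binary.Construct.Closure.ReflexiveTransitive using (Star)
open import Function.Bundles using (_⇔_)

record Graph : Set where
  field
    n      : ℕ
    adj    : Fin n → Fin n → Bool
    sym    : ∀ u v → adj u v ≡ adj v u
    irrefl : ∀ v → adj v v ≡ false
open Graph public

VSet : Graph → Set₁
VSet G = Fin (n G) → Set

EdgeIn : (G : Graph) → VSet G → Fin (n G) → Fin (n G) → Set
EdgeIn G S x y = S x × S y × adj G x y ≡ true

ConnIn : (G : Graph) → VSet G → Fin (n G) → Fin (n G) → Set
ConnIn G S u v = S u × S v × Star (EdgeIn G S) u v

-- G contains K_t as a minor: there are t nonempty, pairwise disjoint branch
-- sets (vertex v belongs to branch set i iff β v ≡ just i), each inducing a
-- connected subgraph, and any two distinct branch sets are joined by an edge.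
HasKMinor : ℕ → Graph → Set
HasKMinor t G =
  Σ (Fin (n G) → Maybe (Fin t)) λ β →
    (∀ i → ∃ λ v → β v ≡ just i)
  × (∀ i u v → β u ≡ just i → β v ≡ just i → ConnIn G (λ x → β x ≡ just i) u v)
  × (∀ i j → i ≢ j → ∃₂ λ u v → β u ≡ just i × β v ≡ just j × adj G u v ≡ true)

MonoConn : {C : Set} (G : Graph) → (Fin (n G) → C) → C → Fin (n G) → Fin (n G) → Set
MonoConn G c a = ConnIn G (λ x → c x ≡ a)

SmallComponents : {C : Set} (G : Graph) → (Fin (n G) → C) → C → ℕ → Set
SmallComponents G c a k =
  ∀ v → c v ≡ a → (L : List (Fin (n G))) → Unique L →
    All (MonoConn G c a v) L → length L ≤ k

PathComponents : {C : Set} (G : Graph) → (Fin (n G) → C) → C → Set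
PathComponents G c a =
  ∀ v → c v ≡ a → Σ (List (Fin (n G))) λ L →
    Unique L
  × (∀ u → (u ∈ L) ⇔ MonoConn G c a v u)
  × (∀ i j → (adj G (lookup L i) (lookup L j) ≡ true)
               ⇔ ((toℕ i + 1 ≡ toℕ j) ⊎ (toℕ j + 1 ≡ toℕ i)))

-- The graph is coloured greedily, one connected bag at a time, with K = t − 1 colour pairs;
-- a bag uses one pair, its few junction vertices get the small colour and the rest, a union
-- of pairwise non-adjacent induced paths, the path colour. Invariant: adjacent vertices of
-- different bags get different pairs, and the bags next to any one uncoloured component
-- pairwise touch. Take an uncoloured component C. If all K pairs are seen on bags next to C,
-- then one such bag per pair together with C are the branch sets of a K_t minor. Otherwise
-- some pair a₀ is unseen and at most t − 2 pairs are seen. Inside C, join two of them by a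
-- shortest path, and reach each further one by a shortest path from what is built so far:
-- its first vertex becomes a junction and the rest lies at distance at least 2 from it, so it
-- is an induced path with no edge to the earlier part. This uses at most t − 4 junctions.
-- Coloured with a₀ this becomes a new bag, and the invariant survives because every bag next
-- to a component of C minus the new bag is seen from C, hence touched by the new bag.

module Submission where

open import Defs
open import Data.Nat using (ℕ; zero; suc; _≤_; _<_; _+_; _∸_; z≤n; s≤s; _≤?_)
open import Data.Nat.Properties
  using (≤-refl; ≤-trans; ≤-pred; ≤-reflexive; <⇒≤; <⇒≢; ≰⇒>; n≤1+n; m≤n⇒m≤1+n; m≤n⇒m<n∨m≡n; <-cmp; <-irrefl;
         ≤-antisym; +-comm; +-suc; +-identityʳ; m≤m+n; m+[n∸m]≡n; n∸n≡0; m∸n+n≡m;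
         +-∸-assoc; ∸-cancelʳ-≤; ∸-cancelˡ-≡)
  renaming (_≟_ to _≟ℕ_)
open import Data.Nat.Induction using (<-wellFounded)
open import Data.Fin using (Fin; zero; suc; toℕ; fromℕ; inject₁)
open import Data.Fin.Relation.Unary.Top using (view; ‵fromℕ; ‵inject₁)
open import Data.Fin.Properties using (_≟_; any?; all?; ¬∀⟶∃¬; toℕ<n; inject₁-injective; fromℕ≢inject₁)
open import Data.Bool using (Bool; true; false; _∧_; _∨_; if_then_else_)
open import Data.Bool.Properties using (not-¬; ¬-not) renaming (_≟_ to _≟ᵇ_)
open import Data.Maybe using (Maybe; just; nothing; is-just; is-nothing; _<∣>_)
open import Data.Maybe.Properties using (just-injective)
open import Data.Product using (Σ; ∃; ∃₂; _×_; _,_; proj₁; proj₂)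
open import Data.Sum using (_⊎_; inj₁; inj₂)
open import Data.Empty using (⊥; ⊥-elim)
open import Data.List using (List; []; _∷_; _++_; length; lookup; filter; allFin; applyUpTo)
open import Data.List.Properties using (filter-notAll; length-tabulate; length-applyUpTo; lookup-applyUpTo)
open import Data.List.Relation.Unary.Any using (here; there)
import Data.List.Relation.Unary.Any as Any
open import Data.List.Relation.Unary.All using (All; []; _∷_)
import Data.List.Relation.Unary.All as All
open import Data.List.Relation.Unary.Unique.Propositional using (Unique; []; _∷_)
open import Data.List.Relation.Unary.Unique.Propositional.Properties using (applyUpTo⁺₁)
open import Data.List.Membership.Propositional using (_∈_)
import Data.List.Membership.DecPropositional as DecMembership
open import Data.List.Membership.Propositional.Properties
  using (∈-filter⁺; ∈-filter⁻; ∈-allFin; ∈-++⁺ˡ; ∈-++⁺ʳ; ∈-++⁻; ∈-applyUpTo⁺; ∈-applyUpTo⁻)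
open import Relation.Nullary using (¬_; Dec; yes; no; does; ¬?)
open import Relation.Nullary.Decidable using (_×-dec_; dec-true)
open import Relation.Binary.PropositionalEquality
  using (_≡_; _≢_; refl; trans; cong; subst; subst₂) renaming (sym to ≡-sym)
open import Relation.Binary.Construct.Closure.ReflexiveTransitive using (Star; ε; _◅_; _◅◅_)
import Relation.Binary.Construct.Closure.ReflexiveTransitive as Star
open import Relation.Binary.Definitions using (tri<; tri≈; tri>)
open import Induction.WellFounded using (Acc; acc)
open import Function using (_∘_; case_of_)
open import Function.Bundles using (_⇔_; mk⇔; Equivalence)

count : ∀ {m} → (Fin m → Bool) → ℕ
count {zero}  f = 0
count {suc m} f = (if f zero then 1 else 0) + count (f ∘ suc)

count≤ : ∀ {m} (f : Fin m → Bool) → count f ≤ m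
count≤ {zero}  f = z≤n
count≤ {suc m} f with f zero
... | true  = s≤s (count≤ (f ∘ suc))
... | false = m≤n⇒m≤1+n (count≤ (f ∘ suc))

_⊆ᵇ_ : ∀ {m} → (Fin m → Bool) → (Fin m → Bool) → Set
f ⊆ᵇ g = ∀ x → f x ≡ true → g x ≡ true

count-mono : ∀ {m} (f g : Fin m → Bool) → f ⊆ᵇ g → count f ≤ count g
count-mono {zero}  f g f⊆g = z≤n
count-mono {suc m} f g f⊆g with f zero in f0 | g zero in g0
... | true  | true  = s≤s (count-mono (f ∘ suc) (g ∘ suc) (f⊆g ∘ suc))
... | true  | false with () ← trans (≡-sym (f⊆g zero f0)) g0
... | false | true  = m≤n⇒m≤1+n (count-mono (f ∘ suc) (g ∘ suc) (f⊆g ∘ suc))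
... | false | false = count-mono (f ∘ suc) (g ∘ suc) (f⊆g ∘ suc)

count-mono-< : ∀ {m} (f g : Fin m → Bool) → f ⊆ᵇ g → ∀ x → g x ≡ true → f x ≡ false → count f < count g
count-mono-< {suc m} f g f⊆g zero gx fx rewrite gx | fx = s≤s (count-mono (f ∘ suc) (g ∘ suc) (f⊆g ∘ suc))
count-mono-< {suc m} f g f⊆g (suc x) gx fx with f zero in f0 | g zero in g0
... | true  | true  = s≤s (count-mono-< (f ∘ suc) (g ∘ suc) (f⊆g ∘ suc) x gx fx)
... | true  | false with () ← trans (≡-sym (f⊆g zero f0)) g0
... | false | true  = m≤n⇒m≤1+n (count-mono-< (f ∘ suc) (g ∘ suc) (f⊆g ∘ suc) x gx fx)
... | false | false = count-mono-< (f ∘ suc) (g ∘ suc) (f⊆g ∘ suc) x gx fx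

Unique-⊆⇒length≤ : ∀ {m} (xs ys : List (Fin m)) → Unique xs → (∀ x → x ∈ xs → x ∈ ys) → length xs ≤ length ys
Unique-⊆⇒length≤ []       ys _            _     = z≤n
Unique-⊆⇒length≤ (x ∷ xs) ys (x∉xs ∷ !xs) xs⊆ys =
  ≤-trans (s≤s (Unique-⊆⇒length≤ xs ys-x !xs xs⊆ys-x))
          (filter-notAll ≢x? ys (Any.map (λ { refl x≢x → x≢x refl }) (xs⊆ys x (here refl))))
  where
  ≢x? = λ y → ¬? (y ≟ x)
  ys-x = filter ≢x? ys
  xs⊆ys-x : ∀ y → y ∈ xs → y ∈ ys-x
  xs⊆ys-x y y∈xs = ∈-filter⁺ ≢x? (xs⊆ys y (there y∈xs)) λ { refl → All.lookup x∉xs y∈xs refl }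

∧-intro : ∀ {a b} → a ≡ true → b ≡ true → a ∧ b ≡ true
∧-intro refl refl = refl

∧-elimˡ : ∀ {a b} → a ∧ b ≡ true → a ≡ true
∧-elimˡ {true} _ = refl

∧-elimʳ : ∀ {a b} → a ∧ b ≡ true → b ≡ true
∧-elimʳ {true} e = e

∨-introˡ : ∀ {a b} → a ≡ true → a ∨ b ≡ true
∨-introˡ refl = refl

∨-introʳ : ∀ {a b} → b ≡ true → a ∨ b ≡ true
∨-introʳ {true}  _ = refl
∨-introʳ {false} e = e

∨-elim : ∀ {a b} → a ∨ b ≡ true → (a ≡ true) ⊎ (b ≡ true)
∨-elim {true}  _ = inj₁ refl
∨-elim {false} e = inj₂ e

any?ᵇ : ∀ {m} (f : Fin m → Bool) → Dec (∃ λ x → f x ≡ true)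
any?ᵇ f = any? (λ x → f x ≟ᵇ true)

does-true⇒ : ∀ {A : Set} (a? : Dec A) → does a? ≡ true → A
does-true⇒ (yes a) _ = a

anyᵇ : ∀ {m} → (Fin m → Bool) → Bool
anyᵇ f = does (any?ᵇ f)

anyᵇ-intro : ∀ {m} (f : Fin m → Bool) x → f x ≡ true → anyᵇ f ≡ true
anyᵇ-intro f x fx = dec-true (any?ᵇ f) (x , fx)

anyᵇ-elim : ∀ {m} (f : Fin m → Bool) → anyᵇ f ≡ true → ∃ λ x → f x ≡ true
anyᵇ-elim f = does-true⇒ (any?ᵇ f)

choose : ∀ {m} → (Fin m → Bool) → Fin m → Fin m
choose f default with any?ᵇ f
... | yes (x , _) = x
... | no  _       = default

choose-sound : ∀ {m} (f : Fin m → Bool) default x → f x ≡ true → f (choose f default) ≡ true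
choose-sound f default x fx with any?ᵇ f
... | yes (_ , fy) = fy
... | no  none     = ⊥-elim (none (x , fx))

<∣>-just⁻ : ∀ {A : Set} (p q : Maybe A) {k} → (p <∣> q) ≡ just k → (p ≡ just k) ⊎ (p ≡ nothing × q ≡ just k)
<∣>-just⁻ (just _) q e = inj₁ e
<∣>-just⁻ nothing  q e = inj₂ (refl , e)

least : (P : ℕ → Set) → (∀ d → Dec (P d)) → ∀ k → P k → ∃ λ d → P d × (∀ d′ → d′ < d → ¬ P d′)
least P P? zero    pk = zero , pk , λ _ ()
least P P? (suc k) pk with least (P ∘ suc) (P? ∘ suc) k pk | P? zero
... | _            | yes p0 = zero , p0 , λ _ ()
... | d , pd , min | no ¬p0 = suc d , pd , λ { zero _ → ¬p0 ; (suc d′) (s≤s d′<d) → min d′ d′<d }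

d∸b≤1+[d∸a]⇒a≤1+b : ∀ {d a b} → a ≤ d → b ≤ d → d ∸ b ≤ suc (d ∸ a) → a ≤ suc b
d∸b≤1+[d∸a]⇒a≤1+b {d} {a} {b} a≤d b≤d h =
  ∸-cancelʳ-≤ (≤-trans a≤d (n≤1+n d)) (subst (d ∸ b ≤_) (≡-sym (+-∸-assoc 1 a≤d)) h)

close⇒consecutive : ∀ a b → a ≤ suc b → b ≤ suc a → a ≢ b → (a + 1 ≡ b) ⊎ (b + 1 ≡ a)
close⇒consecutive a b a≤1+b b≤1+a a≢b with <-cmp a b
... | tri≈ _ a≡b _ = ⊥-elim (a≢b a≡b)
... | tri< a<b _ _ = inj₁ (trans (+-comm a 1) (≤-antisym a<b b≤1+a))
... | tri> _ _ b<a = inj₂ (trans (+-comm b 1) (≤-antisym b<a a≤1+b))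

module Walks (G : Graph) where

  V : Set
  V = Fin (n G)

  adj-sym : ∀ {x y} → adj G x y ≡ true → adj G y x ≡ true
  adj-sym = trans (sym G _ _)

  walk-reverse : ∀ {S : VSet G} {x y} → Star (EdgeIn G S) x y → Star (EdgeIn G S) y x
  walk-reverse = Star.reverse λ (sx , sy , e) → sy , sx , adj-sym e

  walk-mono : ∀ {S S′ : VSet G} → (∀ x → S x → S′ x) → ∀ {x y} → Star (EdgeIn G S) x y → Star (EdgeIn G S′) x y
  walk-mono S⊆S′ = Star.map λ (sx , sy , e) → S⊆S′ _ sx , S⊆S′ _ sy , e

  Consecutive : ∀ {ℓ} → Fin ℓ → Fin ℓ → Set
  Consecutive i j = (toℕ i + 1 ≡ toℕ j) ⊎ (toℕ j + 1 ≡ toℕ i)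

  InducedPath : List V → Set
  InducedPath L = Unique L × (∀ i j → (adj G (lookup L i) (lookup L j) ≡ true) ⇔ Consecutive i j)

  ConsecutiveAdjacent : List V → Set
  ConsecutiveAdjacent L = ∀ i j → Consecutive i j → adj G (lookup L i) (lookup L j) ≡ true

  singleton-inducedPath : ∀ v → InducedPath (v ∷ [])
  singleton-inducedPath v =
    [] ∷ [] , λ { zero zero → mk⇔ (λ e → ⊥-elim (not-¬ e (irrefl G v))) λ { (inj₁ ()) ; (inj₂ ()) } }

  private
    consecutiveAdjacent-tail : ∀ x xs → ConsecutiveAdjacent (x ∷ xs) → ConsecutiveAdjacent xs
    consecutiveAdjacent-tail x xs h i j (inj₁ e) = h (suc i) (suc j) (inj₁ (cong suc e))
    consecutiveAdjacent-tail x xs h i j (inj₂ e) = h (suc i) (suc j) (inj₂ (cong suc e))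

    walk-from-head : ∀ {P : VSet G} x xs → ConsecutiveAdjacent (x ∷ xs) → All P (x ∷ xs) →
                     ∀ {w} → w ∈ x ∷ xs → Star (EdgeIn G P) x w
    walk-from-head x xs       h _                (here refl) = ε
    walk-from-head x (y ∷ xs) h (px ∷ py ∷ all) (there w∈) =
      (px , py , h zero (suc zero) (inj₁ refl))
        ◅ walk-from-head y xs (consecutiveAdjacent-tail x (y ∷ xs) h) (py ∷ all) w∈

  consecutiveAdjacent⇒connected : ∀ {P : VSet G} L → ConsecutiveAdjacent L → All P L →
                                  ∀ {z w} → z ∈ L → w ∈ L → Star (EdgeIn G P) z w
  consecutiveAdjacent⇒connected (x ∷ xs) h all z∈ w∈ =
    walk-reverse (walk-from-head x xs h all z∈) ◅◅ walk-from-head x xs h all w∈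

module Pieces (G : Graph) (K : ℕ) where

  open Walks G

  -- A piece is the set of vertices of one bag with one colour: a small piece need not be
  -- connected, only its size is bounded; a path piece is a single induced path.
  data Piece : Set where
    small : Fin K → List V → Piece
    path  : Fin K → List V → Piece

  colour : Piece → Fin K ⊎ Fin K
  colour (small a _) = inj₁ a
  colour (path  a _) = inj₂ a

  colourPair : Piece → Fin K
  colourPair (small a _) = a
  colourPair (path  a _) = a

  colour⇒colourPair : ∀ p q → colour p ≡ colour q → colourPair p ≡ colourPair q
  colour⇒colourPair (small a _) (small .a _) refl = refl
  colour⇒colourPair (path  a _) (path  .a _) refl = refl

  module FromPieces {k : ℕ} (piece : V → Piece)
    (monochromatic-edge : ∀ x y → adj G x y ≡ true → colour (piece x) ≡ colour (piece y) → piece x ≡ piece y)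
    (small-piece : ∀ x a L → piece x ≡ small a L → length L ≤ k × (∀ y → piece y ≡ small a L → y ∈ L))
    (path-piece : ∀ x a L → piece x ≡ path a L → InducedPath L × (∀ y → (y ∈ L) ⇔ (piece y ≡ path a L)))
    where

    colouring : V → Fin K ⊎ Fin K
    colouring x = colour (piece x)

    monochromatic-walk⇒same-piece : ∀ {α v w} → Star (EdgeIn G (λ x → colouring x ≡ α)) v w → piece w ≡ piece v
    monochromatic-walk⇒same-piece ε = refl
    monochromatic-walk⇒same-piece ((cv , cw , e) ◅ walk) =
      trans (monochromatic-walk⇒same-piece walk) (≡-sym (monochromatic-edge _ _ e (trans cv (≡-sym cw))))

    private
      small-for : ∀ a v p → piece v ≡ p → colour p ≡ inj₁ a → (L : List V) → Unique L →
                  All (MonoConn G colouring (inj₁ a) v) L → length L ≤ k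
      small-for a v (small a′ L₀) pv _ L !L conn =
        ≤-trans (Unique-⊆⇒length≤ L L₀ !L λ x x∈L →
                   proj₂ (small-piece v a′ L₀ pv) x
                     (trans (monochromatic-walk⇒same-piece (proj₂ (proj₂ (All.lookup conn x∈L)))) pv))
                (proj₁ (small-piece v a′ L₀ pv))

      path-for : ∀ a v p → piece v ≡ p → colour p ≡ inj₂ a → Σ (List V) λ L →
                 Unique L
               × (∀ u → (u ∈ L) ⇔ MonoConn G colouring (inj₂ a) v u)
               × (∀ i j → (adj G (lookup L i) (lookup L j) ≡ true) ⇔ ((toℕ i + 1 ≡ toℕ j) ⊎ (toℕ j + 1 ≡ toℕ i)))
      path-for a v (path .a L) pv refl = L , proj₁ induced , (λ u → mk⇔ (to u) (from u)) , proj₂ induced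
        where
        induced = proj₁ (path-piece v a L pv)
        members = proj₂ (path-piece v a L pv)
        coloured : All (λ x → colouring x ≡ inj₂ a) L
        coloured = All.tabulate λ {x} x∈L → cong colour (Equivalence.to (members x) x∈L)
        to : ∀ u → u ∈ L → MonoConn G colouring (inj₂ a) v u
        to u u∈L = cong colour pv , cong colour (Equivalence.to (members u) u∈L)
                 , consecutiveAdjacent⇒connected L (λ i j → Equivalence.from (proj₂ induced i j)) coloured
                     (Equivalence.from (members v) pv) u∈L
        from : ∀ u → MonoConn G colouring (inj₂ a) v u → u ∈ L
        from u (_ , _ , walk) = Equivalence.from (members u) (trans (monochromatic-walk⇒same-piece walk) pv)

    small-components : ∀ a → SmallComponents G colouring (inj₁ a) k
    small-components a v cv = small-for a v (piece v) refl cv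

    path-components : ∀ a → PathComponents G colouring (inj₂ a)
    path-components a v cv = path-for a v (piece v) refl cv

module Layers (G : Graph) (W A : Fin (n G) → Bool) where

  open Walks G

  ball : ℕ → V → Bool
  ball zero    x = A x ∧ W x
  ball (suc k) x = ball k x ∨ (W x ∧ anyᵇ (λ y → ball k y ∧ adj G x y))

  ball⊆W : ∀ k x → ball k x ≡ true → W x ≡ true
  ball⊆W zero    x e = ∧-elimʳ {A x} e
  ball⊆W (suc k) x e with ∨-elim {ball k x} e
  ... | inj₁ e′ = ball⊆W k x e′
  ... | inj₂ e′ = ∧-elimˡ e′

  ball-suc : ∀ k x → ball k x ≡ true → ball (suc k) x ≡ true
  ball-suc k x = ∨-introˡ

  ball-mono : ∀ j k x → j ≤ k → ball j x ≡ true → ball k x ≡ true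
  ball-mono j k x j≤k e with m≤n⇒m<n∨m≡n j≤k
  ... | inj₂ refl = e
  ball-mono j (suc k) x _ e | inj₁ (s≤s j≤k) = ball-suc k x (ball-mono j k x j≤k e)

  ball-step : ∀ k x y → ball k y ≡ true → W x ≡ true → adj G x y ≡ true → ball (suc k) x ≡ true
  ball-step k x y y∈ Wx xy = ∨-introʳ {ball k x} (∧-intro Wx (anyᵇ-intro (λ z → ball k z ∧ adj G x z) y (∧-intro y∈ xy)))

  ball-suc-cases : ∀ k x → ball (suc k) x ≡ true →
                   (ball k x ≡ true) ⊎ (W x ≡ true × ∃ λ y → ball k y ≡ true × adj G x y ≡ true)
  ball-suc-cases k x e with ∨-elim {ball k x} e
  ... | inj₁ e′ = inj₁ e′
  ... | inj₂ e′ with anyᵇ-elim (λ z → ball k z ∧ adj G x z) (∧-elimʳ {W x} e′)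
  ... | y , e″ = inj₂ (∧-elimˡ e′ , y , ∧-elimˡ e″ , ∧-elimʳ {ball k y} e″)

  ball⇒walk : ∀ k x → ball k x ≡ true → ∃ λ a → A a ≡ true × Star (EdgeIn G (λ z → ball k z ≡ true)) a x
  ball⇒walk zero    x e = x , ∧-elimˡ e , ε
  ball⇒walk (suc k) x e with ball-suc-cases k x e
  ... | inj₁ e′ with ball⇒walk k x e′
  ... | a , Aa , walk = a , Aa , walk-mono (ball-suc k) walk
  ball⇒walk (suc k) x e | inj₂ (_ , y , y∈ , xy) with ball⇒walk k y y∈
  ... | a , Aa , walk = a , Aa , walk-mono (ball-suc k) walk ◅◅ ((ball-suc k y y∈ , e , adj-sym xy) ◅ ε)

  walk⇒ball : ∀ a x → A a ≡ true → W a ≡ true → Star (EdgeIn G (λ z → W z ≡ true)) a x → ∃ λ k → ball k x ≡ true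
  walk⇒ball a x Aa Wa = go (zero , ∧-intro Aa Wa)
    where
    go : ∀ {y} → (∃ λ k → ball k y ≡ true) → Star (EdgeIn G (λ z → W z ≡ true)) y x → ∃ λ k → ball k x ≡ true
    go y∈ ε = y∈
    go (k , y∈) ((_ , Wz , yz) ◅ walk) = go (suc k , ball-step k _ _ y∈ Wz (adj-sym yz)) walk

  Sphere : ℕ → V → Set
  Sphere zero    x = ball zero x ≡ true
  Sphere (suc k) x = ball (suc k) x ≡ true × ball k x ≡ false

  sphere⊆ball : ∀ k x → Sphere k x → ball k x ≡ true
  sphere⊆ball zero    x e       = e
  sphere⊆ball (suc k) x (e , _) = e

  sphere⊆W : ∀ k x → Sphere k x → W x ≡ true
  sphere⊆W k x e = ball⊆W k x (sphere⊆ball k x e)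

  sphere-outside : ∀ k j x → Sphere k x → j < k → ball j x ≡ false
  sphere-outside (suc k) j x (_ , x∉) (s≤s j≤k) with ball j x in e
  ... | false = refl
  ... | true with () ← trans (≡-sym (ball-mono j k x j≤k e)) x∉

  sphere-unique : ∀ i j x → Sphere i x → Sphere j x → i ≡ j
  sphere-unique i j x si sj with <-cmp i j
  ... | tri≈ _ i≡j _ = i≡j
  ... | tri< i<j _ _ = ⊥-elim (not-¬ (sphere⊆ball i x si) (sphere-outside j i x sj i<j))
  ... | tri> _ _ j<i = ⊥-elim (not-¬ (sphere⊆ball j x sj) (sphere-outside i j x si j<i))

  sphere-adjacent : ∀ i j x y → Sphere i x → Sphere j y → adj G x y ≡ true → j ≤ suc i
  sphere-adjacent i j x y si sj xy with j ≤? suc i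
  ... | yes j≤1+i = j≤1+i
  ... | no  j≰1+i = ⊥-elim (not-¬ (ball-step i y x (sphere⊆ball i x si) (sphere⊆W j y sj) (adj-sym xy))
                                  (sphere-outside j (suc i) y sj (≰⇒> j≰1+i)))

  sphere-down : ∀ k x y → Sphere (suc k) x → adj G x y ≡ true → ball k y ≡ true → Sphere k y
  sphere-down zero    x y _        xy y∈ = y∈
  sphere-down (suc k) x y (x∈ , x∉) xy y∈ with ball k y in e
  ... | false = y∈ , refl
  ... | true with () ← trans (≡-sym (ball-step k x y e (ball⊆W (suc (suc k)) x x∈) xy)) x∉

  sphere-predecessor : ∀ k x → Sphere (suc k) x → ∃ λ y → Sphere k y × adj G x y ≡ true
  sphere-predecessor k x (x∈ , x∉) with ball-suc-cases k x x∈
  ... | inj₁ x∈′ = ⊥-elim (not-¬ x∈′ x∉)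
  ... | inj₂ (_ , y , y∈ , xy) = y , sphere-down k x y (x∈ , x∉) xy y∈ , xy

  sphere-suc-∉A : ∀ k x → Sphere (suc k) x → A x ≡ false
  sphere-suc-∉A k x s with A x in Ax
  ... | false = refl
  ... | true with () ← trans (≡-sym (∧-intro Ax (sphere⊆W (suc k) x s))) (sphere-outside (suc k) zero x s (s≤s z≤n))

  sphere-2+-nonadjacent-A : ∀ k x a → Sphere (suc (suc k)) x → A a ≡ true → W a ≡ true → adj G x a ≡ true → ⊥
  sphere-2+-nonadjacent-A k x a s Aa Wa xa =
    not-¬ (ball-step zero x a (∧-intro Aa Wa) (sphere⊆W (suc (suc k)) x s) xa)
          (sphere-outside (suc (suc k)) 1 x s (s≤s (s≤s z≤n)))

  record Geodesic (d : ℕ) : Set where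
    field
      vertex    : ℕ → V
      on-sphere : ∀ s → s ≤ d → Sphere (d ∸ s) (vertex s)
      step      : ∀ s → suc s ≤ d → adj G (vertex s) (vertex (suc s)) ≡ true

  module GeodesicProperties {d : ℕ} (γ : Geodesic d) where

    open Geodesic γ

    vertex-injective : ∀ s s′ → s ≤ d → s′ ≤ d → vertex s ≡ vertex s′ → s ≡ s′
    vertex-injective s s′ s≤d s′≤d e =
      ∸-cancelˡ-≡ s≤d s′≤d
        (sphere-unique (d ∸ s) (d ∸ s′) (vertex s) (on-sphere s s≤d) (subst (Sphere (d ∸ s′)) (≡-sym e) (on-sphere s′ s′≤d)))

    adjacent⇒consecutive : ∀ a b → a ≤ d → b ≤ d → adj G (vertex a) (vertex b) ≡ true → (a + 1 ≡ b) ⊎ (b + 1 ≡ a)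
    adjacent⇒consecutive a b a≤d b≤d e = close⇒consecutive a b
      (d∸b≤1+[d∸a]⇒a≤1+b a≤d b≤d (sphere-adjacent (d ∸ a) (d ∸ b) _ _ (on-sphere a a≤d) (on-sphere b b≤d) e))
      (d∸b≤1+[d∸a]⇒a≤1+b b≤d a≤d (sphere-adjacent (d ∸ b) (d ∸ a) _ _ (on-sphere b b≤d) (on-sphere a a≤d) (adj-sym e)))
      (λ { refl → not-¬ e (irrefl G (vertex a)) })

    consecutive⇒adjacent : ∀ a b → a ≤ d → b ≤ d → (a + 1 ≡ b) ⊎ (b + 1 ≡ a) → adj G (vertex a) (vertex b) ≡ true
    consecutive⇒adjacent a b a≤d b≤d (inj₁ e) with trans (+-comm 1 a) e
    ... | refl = step a b≤d
    consecutive⇒adjacent a b a≤d b≤d (inj₂ e) with trans (+-comm 1 b) e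
    ... | refl = adj-sym (step b a≤d)

    prefix-inducedPath : ∀ ℓ → ℓ ≤ suc d → InducedPath (applyUpTo vertex ℓ)
    prefix-inducedPath ℓ ℓ≤1+d =
      applyUpTo⁺₁ vertex ℓ (λ i<j j<ℓ e → <⇒≢ i<j (vertex-injective _ _ (on-prefix (≤-trans i<j (<⇒≤ j<ℓ)))
                                                                     (on-prefix j<ℓ) e))
      , λ i j → mk⇔
          (λ e → adjacent⇒consecutive (toℕ i) (toℕ j) (index≤ i) (index≤ j)
                   (subst₂ (λ u v → adj G u v ≡ true) (lookup-applyUpTo vertex ℓ i) (lookup-applyUpTo vertex ℓ j) e))
          (λ c → subst₂ (λ u v → adj G u v ≡ true) (≡-sym (lookup-applyUpTo vertex ℓ i)) (≡-sym (lookup-applyUpTo vertex ℓ j))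
                   (consecutive⇒adjacent (toℕ i) (toℕ j) (index≤ i) (index≤ j) c))
      where
      on-prefix : ∀ {s} → s < ℓ → s ≤ d
      on-prefix s<ℓ = ≤-pred (≤-trans s<ℓ ℓ≤1+d)
      index≤ : ∀ (i : Fin (length (applyUpTo vertex ℓ))) → toℕ i ≤ d
      index≤ i = ≤-pred (≤-trans (subst (toℕ i <_) (length-applyUpTo vertex ℓ) (toℕ<n i)) ℓ≤1+d)

    walk-to-end : ∀ (P : V → Set) → (∀ s → s ≤ d → P (vertex s)) → ∀ j s → s + j ≡ d →
                  Star (EdgeIn G P) (vertex s) (vertex d)
    walk-to-end P on zero    s refl rewrite +-identityʳ s = ε
    walk-to-end P on (suc j) s e =
      (on s (≤-trans (m≤m+n s (suc j)) (≤-reflexive e)) , on (suc s) 1+s≤d , step s 1+s≤d)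
        ◅ walk-to-end P on j (suc s) (trans (≡-sym (+-suc s j)) e)
      where
      1+s≤d : suc s ≤ d
      1+s≤d = ≤-trans (s≤s (m≤m+n s j)) (≤-reflexive (trans (≡-sym (+-suc s j)) e))

    walk-from-end : ∀ (P : V → Set) → (∀ s → s ≤ d → P (vertex s)) → ∀ s → s ≤ d → Star (EdgeIn G P) (vertex d) (vertex s)
    walk-from-end P on s s≤d = walk-reverse (walk-to-end P on (d ∸ s) s (m+[n∸m]≡n s≤d))

    end∈A : A (vertex d) ≡ true
    end∈A = ∧-elimˡ (subst (λ k → Sphere k (vertex d)) (n∸n≡0 d) (on-sphere d ≤-refl))

  sphere⇒geodesic : ∀ d b → Sphere d b → Σ (Geodesic d) λ γ → Geodesic.vertex γ 0 ≡ b
  sphere⇒geodesic d b b-on = record { vertex = vertex ; on-sphere = on-sphere ; step = step } , refl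
    where
    vertex : ℕ → V
    vertex zero    = b
    vertex (suc s) = choose (λ y → ball (d ∸ suc s) y ∧ adj G (vertex s) y) (vertex s)

    descend : ∀ s → suc s ≤ d → Sphere (d ∸ s) (vertex s) →
              Sphere (d ∸ suc s) (vertex (suc s)) × adj G (vertex s) (vertex (suc s)) ≡ true
    descend s 1+s≤d on with subst (λ k → Sphere k (vertex s)) (+-∸-assoc 1 1+s≤d) on
    ... | on′ with sphere-predecessor (d ∸ suc s) (vertex s) on′
    ... | y , y-on , sy = sphere-down (d ∸ suc s) (vertex s) (vertex (suc s)) on′ (∧-elimʳ {ball (d ∸ suc s) _} chosen) (∧-elimˡ chosen)
                        , ∧-elimʳ {ball (d ∸ suc s) _} chosen
      where
      chosen = choose-sound (λ y → ball (d ∸ suc s) y ∧ adj G (vertex s) y) (vertex s) y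
                            (∧-intro (sphere⊆ball _ y y-on) sy)

    on-sphere : ∀ s → s ≤ d → Sphere (d ∸ s) (vertex s)
    on-sphere zero    _     = b-on
    on-sphere (suc s) 1+s≤d = proj₁ (descend s 1+s≤d (on-sphere s (≤-trans (n≤1+n s) 1+s≤d)))

    step : ∀ s → suc s ≤ d → adj G (vertex s) (vertex (suc s)) ≡ true
    step s 1+s≤d = proj₂ (descend s 1+s≤d (on-sphere s (≤-trans (n≤1+n s) 1+s≤d)))

  private
    Hits : (V → Bool) → ℕ → Set
    Hits B d = ∃ λ x → ball d x ≡ true × B x ≡ true

    nearest-on-sphere : ∀ B d x → ball d x ≡ true → B x ≡ true → (∀ d′ → d′ < d → ¬ Hits B d′) → Sphere d x
    nearest-on-sphere B zero     x x∈ Bx nearest = x∈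
    nearest-on-sphere B (suc d′) x x∈ Bx nearest = x∈ , ¬-not λ x∈′ → nearest d′ ≤-refl (x , x∈′ , Bx)

  shortest-geodesic : (B : V → Bool) → ∀ k b → ball k b ≡ true → B b ≡ true →
                      ∃ λ d → Σ (Geodesic d) λ γ → B (Geodesic.vertex γ 0) ≡ true
  shortest-geodesic B k b b∈ Bb
    with d , (x , x∈ , Bx) , nearest ← least (Hits B) (λ d → any? λ x → (ball d x ≟ᵇ true) ×-dec (B x ≟ᵇ true)) k (b , b∈ , Bb)
    with γ , refl ← sphere⇒geodesic d x (nearest-on-sphere B d x x∈ Bx nearest)
    = d , γ , Bx

-- With t = m + 4 there are K = t − 1 colour pairs a, each made of the small colour inj₁ a and
-- the path colour inj₂ a. The colouring is built bag by bag; a coloured vertex records the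
-- index of its bag and its piece.
module State (G : Graph) (m : ℕ) where

  K : ℕ
  K = suc (suc (suc m))

  open Walks G public
  open Pieces G K public

  PartialColouring : Set
  PartialColouring = V → Maybe (ℕ × Piece)

  uncoloured : PartialColouring → V → Bool
  uncoloured st x = is-nothing (st x)

  uncoloured⇒nothing : ∀ st x → uncoloured st x ≡ true → st x ≡ nothing
  uncoloured⇒nothing st x e with st x
  ... | nothing = refl

  nothing⇒uncoloured : ∀ st x → st x ≡ nothing → uncoloured st x ≡ true
  nothing⇒uncoloured st x e rewrite e = refl

  hasPair : PartialColouring → Fin K → V → Bool
  hasPair st a y with st y
  ... | just (_ , p) = does (colourPair p ≟ a)
  ... | nothing      = false

  hasPair-elim : ∀ st a y → hasPair st a y ≡ true → ∃₂ λ b p → st y ≡ just (b , p) × colourPair p ≡ a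
  hasPair-elim st a y e with st y
  ... | just (b , p) with colourPair p ≟ a
  ... | yes pa≡a = b , p , refl , pa≡a

  hasPair-intro : ∀ st a y b p → st y ≡ just (b , p) → colourPair p ≡ a → hasPair st a y ≡ true
  hasPair-intro st a y b p e pa≡a rewrite e with colourPair p ≟ a
  ... | yes _   = refl
  ... | no  pa≢a = ⊥-elim (pa≢a pa≡a)

  InBag : PartialColouring → ℕ → V → Set
  InBag st b x = ∃ λ p → st x ≡ just (b , p)

  InComponent : PartialColouring → V → V → Set
  InComponent st u x = ConnIn G (λ z → st z ≡ nothing) u x

  BagsTouch : PartialColouring → ℕ → ℕ → Set
  BagsTouch st b₁ b₂ = ∃₂ λ z₁ z₂ → InBag st b₁ z₁ × InBag st b₂ z₂ × adj G z₁ z₂ ≡ true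

  record Invariant (st : PartialColouring) (#bags : ℕ) : Set where
    field
      bag<             : ∀ x b p → st x ≡ just (b , p) → b < #bags
      monochromatic-edge : ∀ x y b p p′ → st x ≡ just (b , p) → st y ≡ just (b , p′) → adj G x y ≡ true →
                           colour p ≡ colour p′ → p ≡ p′
      small-piece      : ∀ x b a L → st x ≡ just (b , small a L) →
                         length L ≤ m × (∀ y b′ → st y ≡ just (b′ , small a L) → y ∈ L)
      path-piece       : ∀ x b a L → st x ≡ just (b , path a L) →
                         InducedPath L × (∀ y → (y ∈ L) ⇔ (∃ λ b′ → st y ≡ just (b′ , path a L)))
      bag-connected    : ∀ x y b p p′ → st x ≡ just (b , p) → st y ≡ just (b , p′) → ConnIn G (InBag st b) x y
      bags-around-component-touch :
                         ∀ u x₁ x₂ y₁ y₂ b₁ b₂ p₁ p₂ → st u ≡ nothing → InComponent st u x₁ → InComponent st u x₂ →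
                         adj G x₁ y₁ ≡ true → adj G x₂ y₂ ≡ true → st y₁ ≡ just (b₁ , p₁) → st y₂ ≡ just (b₂ , p₂) →
                         b₁ ≢ b₂ → BagsTouch st b₁ b₂
      touching-bags-differ : ∀ x y b b′ p p′ → st x ≡ just (b , p) → st y ≡ just (b′ , p′) → adj G x y ≡ true →
                           b ≢ b′ → colourPair p ≢ colourPair p′
      bag-colourPair   : ∀ x y b p p′ → st x ≡ just (b , p) → st y ≡ just (b , p′) → colourPair p ≡ colourPair p′

  empty-invariant : Invariant (λ _ → nothing) 0
  empty-invariant = record
    { bag< = λ _ _ _ () ; monochromatic-edge = λ _ _ _ _ _ () ; small-piece = λ _ _ _ _ () ; path-piece = λ _ _ _ _ ()
    ; bag-connected = λ _ _ _ _ _ () ; bags-around-component-touch = λ _ _ _ _ _ _ _ _ _ _ _ _ _ _ () 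
    ; touching-bags-differ = λ _ _ _ _ _ _ () ; bag-colourPair = λ _ _ _ _ _ () }

-- The component of the uncoloured vertex u: the ball around u in the uncoloured vertices,
-- taken at a radius where it has stopped growing.
module Component (G : Graph) (m : ℕ) (st : State.PartialColouring G m) (u : Fin (n G)) (u-free : st u ≡ nothing) where

  open State G m

  open Layers G (uncoloured st) (λ x → does (x ≟ u)) public

  private
    Stable : ℕ → Set
    Stable j = ∀ x → ball (suc j) x ≡ true → ball j x ≡ true

    implies? : ∀ a b → Dec (a ≡ true → b ≡ true)
    implies? a     true  = yes λ _ → refl
    implies? true  false = no λ h → not-¬ (h refl) refl
    implies? false false = yes λ ()

    ¬implies : ∀ a b → ¬ (a ≡ true → b ≡ true) → a ≡ true × b ≡ false
    ¬implies true  false _ = refl , refl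
    ¬implies false _     h = ⊥-elim (h λ ())
    ¬implies true  true  h = ⊥-elim (h λ _ → refl)

    stable-or-growing : ∀ j → (∃ Stable) ⊎ (j ≤ count (ball j))
    stable-or-growing zero = inj₂ z≤n
    stable-or-growing (suc j) with stable-or-growing j
    ... | inj₁ s = inj₁ s
    ... | inj₂ j≤ with all? (λ x → implies? (ball (suc j) x) (ball j x))
    ...   | yes s = inj₁ (j , s)
    ...   | no ¬s with x , ¬i ← ¬∀⟶∃¬ (n G) _ (λ x → implies? (ball (suc j) x) (ball j x)) ¬s
                   with x∈ , x∉ ← ¬implies _ _ ¬i =
      inj₂ (≤-trans (s≤s j≤) (count-mono-< (ball j) (ball (suc j)) (ball-suc j) x x∈ x∉))

    stabilises : ∃ Stable
    stabilises with stable-or-growing (suc (n G))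
    ... | inj₁ s   = s
    ... | inj₂ n<  = ⊥-elim (<-irrefl refl (≤-trans n< (count≤ (ball (suc (n G))))))

  radius : ℕ
  radius = proj₁ stabilises

  component : V → Bool
  component = ball radius

  private
    beyond-radius : ∀ i x → ball (i + radius) x ≡ true → component x ≡ true
    beyond-radius zero    x e = e
    beyond-radius (suc i) x e with ball-suc-cases (i + radius) x e
    ... | inj₁ e′ = beyond-radius i x e′
    ... | inj₂ (Wx , y , y∈ , xy) = proj₂ stabilises x (ball-step radius x y (beyond-radius i y y∈) Wx xy)

  ball⊆component : ∀ j x → ball j x ≡ true → component x ≡ true
  ball⊆component j x e with j ≤? radius
  ... | yes j≤r = ball-mono j radius x j≤r e
  ... | no  j≰r = beyond-radius (j ∸ radius) x
                    (subst (λ k → ball k x ≡ true) (≡-sym (m∸n+n≡m (<⇒≤ (≰⇒> j≰r)))) e)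

  component⇒free : ∀ x → component x ≡ true → st x ≡ nothing
  component⇒free x e = uncoloured⇒nothing st x (ball⊆W radius x e)

  u∈component : component u ≡ true
  u∈component = ball-mono 0 radius u z≤n (∧-intro (dec-true (u ≟ u) refl) (nothing⇒uncoloured st u u-free))

  component⇒InComponent : ∀ x → component x ≡ true → InComponent st u x
  component⇒InComponent x e with ball⇒walk radius x e
  ... | a , a≟u , walk with refl ← does-true⇒ (a ≟ u) a≟u = u-free , component⇒free x e , walk-mono component⇒free walk

  InComponent⇒component : ∀ x → InComponent st u x → component x ≡ true
  InComponent⇒component x (_ , _ , walk)
    with k , x∈ ← walk⇒ball u x (dec-true (u ≟ u) refl) (nothing⇒uncoloured st u u-free)
                     (walk-mono (nothing⇒uncoloured st) walk)
    = ball⊆component k x x∈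

  component-closed : ∀ y x → component y ≡ true → st x ≡ nothing → adj G x y ≡ true → component x ≡ true
  component-closed y x y∈ x-free xy = proj₂ stabilises x (ball-step radius x y y∈ (nothing⇒uncoloured st x x-free) xy)

  private
    free-walk⇒component-walk : ∀ y x → component y ≡ true → Star (EdgeIn G (λ z → st z ≡ nothing)) y x →
                               Star (EdgeIn G (λ z → component z ≡ true)) y x
    free-walk⇒component-walk y .y y∈ ε = ε
    free-walk⇒component-walk y x y∈ ((_ , z-free , yz) ◅ walk) =
      (y∈ , z∈ , yz) ◅ free-walk⇒component-walk _ x z∈ walk
      where z∈ = component-closed y _ y∈ z-free (adj-sym yz)

  component-connected : ∀ x y → component x ≡ true → component y ≡ true → Star (EdgeIn G (λ z → component z ≡ true)) x y
  component-connected x y x∈ y∈ =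
    walk-reverse (free-walk⇒component-walk u x u∈component (proj₂ (proj₂ (component⇒InComponent x x∈))))
      ◅◅ free-walk⇒component-walk u y u∈component (proj₂ (proj₂ (component⇒InComponent y y∈)))

module Contacts (G : Graph) (m : ℕ) (st : State.PartialColouring G m) (u : Fin (n G)) (u-free : st u ≡ nothing) where

  open State G m
  open Component G m st u u-free

  pairSeen : Fin K → Bool
  pairSeen a = anyᵇ (λ y → hasPair st a y ∧ anyᵇ (λ x → component x ∧ adj G x y))

  pairSeen-intro : ∀ a y x → hasPair st a y ≡ true → component x ≡ true → adj G x y ≡ true → pairSeen a ≡ true
  pairSeen-intro a y x ya x∈ xy = anyᵇ-intro _ y (∧-intro ya (anyᵇ-intro _ x (∧-intro x∈ xy)))

  touchesPair : Fin K → V → Bool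
  touchesPair a x = anyᵇ (λ y → adj G x y ∧ hasPair st a y)

  touchesPair-elim : ∀ a x → touchesPair a x ≡ true → ∃ λ y → adj G x y ≡ true × hasPair st a y ≡ true
  touchesPair-elim a x e with y , e′ ← anyᵇ-elim _ e = y , ∧-elimˡ e′ , ∧-elimʳ {adj G x y} e′

  record Contact (a : Fin K) : Set where
    field
      inner        : V
      inner∈       : component inner ≡ true
      outer        : V
      bag          : ℕ
      piece        : Piece
      outer-colour : st outer ≡ just (bag , piece)
      pair         : colourPair piece ≡ a
      edge         : adj G inner outer ≡ true

    inner-touches : touchesPair a inner ≡ true
    inner-touches = anyᵇ-intro _ outer (∧-intro edge (hasPair-intro st a outer bag piece outer-colour pair))

  contact : ∀ a → pairSeen a ≡ true → Contact a
  contact a seen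
    with y , e ← anyᵇ-elim _ seen
    with x , e′ ← anyᵇ-elim _ (∧-elimʳ {hasPair st a y} e)
    with b , p , yp , pa ← hasPair-elim st a y (∧-elimˡ e)
    = record { inner = x ; inner∈ = ∧-elimˡ e′ ; outer = y ; bag = b ; piece = p
             ; outer-colour = yp ; pair = pa ; edge = ∧-elimʳ {component x} e′ }

-- If every colour pair is seen from the component, the bags of the contacts together with
-- the component are the branch sets of a K_{K+1} minor.
module Minor (G : Graph) (m : ℕ) (st : State.PartialColouring G m) (#bags : ℕ) (inv : State.Invariant G m st #bags)
             (u : Fin (n G)) (u-free : st u ≡ nothing) where

  open State G m
  open Invariant inv
  open Component G m st u u-free
  open Contacts G m st u u-free

  module AllPairsSeen (seen : ∀ a → pairSeen a ≡ true) where

    open Contact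

    contacts : ∀ a → Contact a
    contacts a = contact a (seen a)

    bagOf : Fin K → ℕ
    bagOf a = bag (contacts a)

    branchOf : Maybe (ℕ × Piece) → Bool → Maybe (Fin (suc K))
    branchOf (just (b , p)) _ with b ≟ℕ bagOf (colourPair p)
    ... | yes _ = just (inject₁ (colourPair p))
    ... | no  _ = nothing
    branchOf nothing c = if c then just (fromℕ K) else nothing

    branch : V → Maybe (Fin (suc K))
    branch v = branchOf (st v) (component v)

    branchOf-inject₁ : ∀ i c a → branchOf i c ≡ just (inject₁ a) → ∃ λ p → i ≡ just (bagOf a , p)
    branchOf-inject₁ (just (b , p)) c a e with b ≟ℕ bagOf (colourPair p)
    ... | yes refl with refl ← inject₁-injective (just-injective e) = p , refl
    branchOf-inject₁ nothing true a e = ⊥-elim (fromℕ≢inject₁ (just-injective e))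

    branchOf-top : ∀ i c → branchOf i c ≡ just (fromℕ K) → i ≡ nothing × c ≡ true
    branchOf-top (just (b , p)) c e with b ≟ℕ bagOf (colourPair p)
    ... | yes _ = ⊥-elim (fromℕ≢inject₁ (≡-sym (just-injective e)))
    branchOf-top nothing true e = refl , refl

    inBag⇒branch : ∀ a z → InBag st (bagOf a) z → branch z ≡ just (inject₁ a)
    inBag⇒branch a z (p , zp) with refl ← trans (bag-colourPair z _ _ p _ zp (outer-colour (contacts a))) (pair (contacts a))
      rewrite zp with bagOf (colourPair p) ≟ℕ bagOf (colourPair p)
    ... | yes _ = refl
    ... | no  ≢ = ⊥-elim (≢ refl)

    component⇒branch : ∀ z → component z ≡ true → branch z ≡ just (fromℕ K)
    component⇒branch z z∈ rewrite component⇒free z z∈ | z∈ = refl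

    bags-distinct : ∀ a a′ → a ≢ a′ → bagOf a ≢ bagOf a′
    bags-distinct a a′ a≢a′ e = a≢a′ (trans (≡-sym (pair c)) (trans same-pair (pair c′)))
      where
      c = contacts a
      c′ = contacts a′
      same-pair : colourPair (piece c) ≡ colourPair (piece c′)
      same-pair = bag-colourPair (outer c) (outer c′) (bag c) (piece c) (piece c′) (outer-colour c)
                    (subst (λ b → st (outer c′) ≡ just (b , piece c′)) (≡-sym e) (outer-colour c′))

    nonempty : ∀ i → ∃ λ v → branch v ≡ just i
    nonempty i with view i
    ... | ‵fromℕ     = u , component⇒branch u u∈component
    ... | ‵inject₁ a = outer (contacts a) , inBag⇒branch a _ (_ , outer-colour (contacts a))

    connected : ∀ i x y → branch x ≡ just i → branch y ≡ just i → ConnIn G (λ z → branch z ≡ just i) x y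
    connected i x y bx by with view i
    ... | ‵fromℕ = bx , by , walk-mono component⇒branch
                              (component-connected x y (proj₂ (branchOf-top (st x) _ bx)) (proj₂ (branchOf-top (st y) _ by)))
    ... | ‵inject₁ a with px , xp ← branchOf-inject₁ (st x) _ a bx | py , yp ← branchOf-inject₁ (st y) _ a by =
      bx , by , walk-mono (inBag⇒branch a) (proj₂ (proj₂ (bag-connected x y _ px py xp yp)))

    adjacent : ∀ i j → i ≢ j → ∃₂ λ x y → branch x ≡ just i × branch y ≡ just j × adj G x y ≡ true
    adjacent i j i≢j with view i | view j
    ... | ‵fromℕ     | ‵fromℕ      = ⊥-elim (i≢j refl)
    ... | ‵fromℕ     | ‵inject₁ a  = inner c , outer c , component⇒branch _ (inner∈ c) , inBag⇒branch a _ (_ , outer-colour c) , edge c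
      where c = contacts a
    ... | ‵inject₁ a | ‵fromℕ      = outer c , inner c , inBag⇒branch a _ (_ , outer-colour c) , component⇒branch _ (inner∈ c) , adj-sym (edge c)
      where c = contacts a
    ... | ‵inject₁ a | ‵inject₁ a′ = bags-adjacent a a′ λ e → i≢j (cong inject₁ e)
      where
      bags-adjacent : ∀ a a′ → a ≢ a′ → ∃₂ λ x y → branch x ≡ just (inject₁ a) × branch y ≡ just (inject₁ a′) × adj G x y ≡ true
      bags-adjacent a a′ a≢a′
        with z₁ , z₂ , z₁∈ , z₂∈ , z₁z₂ ←
               bags-around-component-touch u (inner (contacts a)) (inner (contacts a′)) (outer (contacts a)) (outer (contacts a′))
                 _ _ _ _ u-free (component⇒InComponent _ (inner∈ (contacts a))) (component⇒InComponent _ (inner∈ (contacts a′)))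
                 (edge (contacts a)) (edge (contacts a′)) (outer-colour (contacts a)) (outer-colour (contacts a′))
                 (bags-distinct a a′ a≢a′)
        = z₁ , z₂ , inBag⇒branch a z₁ z₁∈ , inBag⇒branch a′ z₂ z₂∈ , z₁z₂

    minor : HasKMinor (suc K) G
    minor = branch , nonempty , connected , adjacent

module Connectors (G : Graph) (m : ℕ) (st : State.PartialColouring G m) (u : Fin (n G)) (u-free : st u ≡ nothing) where

  open State G m
  open Component G m st u u-free using (component; u∈component; component-connected)
  open Contacts G m st u u-free
  open Contact
  open DecMembership (_≟_ {n G}) using (_∈?_)

  data Role : Set where
    junction : Role
    onPath   : List V → Role

  member : (V → Maybe Role) → V → Bool
  member role x = is-just (role x)

  member-intro : ∀ role x k → role x ≡ just k → member role x ≡ true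
  member-intro role x k e rewrite e = refl

  member-elim : ∀ role x → member role x ≡ true → ∃ λ k → role x ≡ just k
  member-elim role x e with role x
  ... | just k = k , refl

  non-member : ∀ role x → member role x ≡ false → role x ≡ nothing
  non-member role x e with role x
  ... | nothing = refl

  Reaches : (V → Maybe Role) → Fin K → Set
  Reaches role a = ∃₂ λ x y → member role x ≡ true × adj G x y ≡ true × hasPair st a y ≡ true

  reaches : ∀ role a x → member role x ≡ true → touchesPair a x ≡ true → Reaches role a
  reaches role a x x∈ t with y , xy , ya ← touchesPair-elim a x t = x , y , x∈ , xy , ya

  record Connector (done : List (Fin K)) (bound : ℕ) : Set where
    field
      role         : V → Maybe Role
      junctions    : List V
      root         : V
      root∈        : member role root ≡ true
      ⊆component   : ∀ x k → role x ≡ just k → component x ≡ true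
      reachable    : ∀ x k → role x ≡ just k → Star (EdgeIn G (λ z → member role z ≡ true)) root x
      junction⇒∈   : ∀ x → role x ≡ just junction → x ∈ junctions
      ∈⇒junction   : ∀ x → x ∈ junctions → role x ≡ just junction
      #junctions   : length junctions ≤ bound
      path-induced : ∀ x L → role x ≡ just (onPath L) → InducedPath L × (∀ y → (y ∈ L) ⇔ (role y ≡ just (onPath L)))
      paths-apart  : ∀ x y L L′ → adj G x y ≡ true → role x ≡ just (onPath L) → role y ≡ just (onPath L′) → L ≡ L′
      reaches-done : ∀ a → a ∈ done → Reaches role a

    member⇒component : ∀ z → member role z ≡ true → component z ≡ true
    member⇒component z z∈ with k , e ← member-elim role z z∈ = ⊆component z k e

  widen : ∀ {done done′ bound bound′} (T : Connector done bound) → (∀ a → a ∈ done′ → Reaches (Connector.role T) a) →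
          bound ≤ bound′ → Connector done′ bound′
  widen T reaches′ bound≤ = record
    { role = role ; junctions = junctions ; root = root ; root∈ = root∈ ; ⊆component = ⊆component
    ; reachable = reachable ; junction⇒∈ = junction⇒∈ ; ∈⇒junction = ∈⇒junction ; #junctions = ≤-trans #junctions bound≤
    ; path-induced = path-induced ; paths-apart = paths-apart ; reaches-done = reaches′ }
    where open Connector T

  relax : ∀ {done done′ bound bound′} → Connector done bound → (∀ a → a ∈ done′ → a ∈ done) → bound ≤ bound′ →
          Connector done′ bound′
  relax T done′⊆done = widen T λ a a∈ → Connector.reaches-done T a (done′⊆done a a∈)

  module OnePath (done : List (Fin K)) (L : List V) (x₀ : V) (x₀∈L : x₀ ∈ L) (induced : InducedPath L)
                 (L⊆component : ∀ x → x ∈ L → component x ≡ true)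
                 (touch : ∀ a → a ∈ done → ∃ λ x → x ∈ L × touchesPair a x ≡ true) where

    role : V → Maybe Role
    role x with x ∈? L
    ... | yes _ = just (onPath L)
    ... | no  _ = nothing

    role-∈ : ∀ {x} → x ∈ L → role x ≡ just (onPath L)
    role-∈ {x} x∈L with x ∈? L
    ... | yes _   = refl
    ... | no  x∉L = ⊥-elim (x∉L x∈L)

    role⁻ : ∀ {x k} → role x ≡ just k → x ∈ L × k ≡ onPath L
    role⁻ {x} e with x ∈? L
    role⁻ refl | yes x∈L = x∈L , refl

    connector : Connector done 0
    connector = record
      { role = role ; junctions = [] ; root = x₀ ; root∈ = member-intro role x₀ _ (role-∈ x₀∈L)
      ; ⊆component = λ x k e → L⊆component x (proj₁ (role⁻ e))
      ; reachable = λ x k e → consecutiveAdjacent⇒connected L (λ i j → Equivalence.from (proj₂ induced i j))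
                                (All.tabulate λ {y} y∈L → member-intro role y _ (role-∈ y∈L)) x₀∈L (proj₁ (role⁻ e))
      ; junction⇒∈ = λ x e → case-junction (proj₂ (role⁻ e))
      ; ∈⇒junction = λ _ ()
      ; #junctions = z≤n
      ; path-induced = λ { x L′ e → case-path (proj₂ (role⁻ e)) }
      ; paths-apart = λ x y L₁ L₂ _ e₁ e₂ → trans (onPath-injective (proj₂ (role⁻ e₁)))
                                                  (≡-sym (onPath-injective (proj₂ (role⁻ e₂))))
      ; reaches-done = λ a a∈ → let x , x∈L , t = touch a a∈ in reaches role a x (member-intro role x _ (role-∈ x∈L)) t }
      where
      onPath-injective : ∀ {L₁ L₂} → onPath L₁ ≡ onPath L₂ → L₁ ≡ L₂
      onPath-injective refl = refl
      case-junction : ∀ {x} → junction ≡ onPath L → x ∈ []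
      case-junction ()
      case-path : ∀ {L′} → onPath L′ ≡ onPath L → InducedPath L′ × (∀ y → (y ∈ L′) ⇔ (role y ≡ just (onPath L′)))
      case-path refl = induced , λ y → mk⇔ role-∈ (proj₁ ∘ role⁻)

  singleton : ∀ done v → component v ≡ true → (∀ a → a ∈ done → touchesPair a v ≡ true) → Connector done m
  singleton done v v∈ touch =
    relax (OnePath.connector done (v ∷ []) v (here refl) (singleton-inducedPath v) (λ { _ (here refl) → v∈ })
                             (λ a a∈ → v , here refl , touch a a∈))
          (λ _ a∈ → a∈) z≤n

  -- Extending a connector to a further seen colour pair a: a shortest path inside the component
  -- from the connector to a vertex touching a. Its vertex next to the connector becomes a new
  -- junction; the rest, being at distance at least 2 from the connector, is a new induced path
  -- with no edge to the old connector.
  module Extend {done bound} (T : Connector done bound) (a : Fin K) (seen : pairSeen a ≡ true) where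

    open Connector T
    open Layers G component (member role)

    module Grow (d : ℕ) (γ : Geodesic (suc d)) (touches : touchesPair a (Geodesic.vertex γ 0) ≡ true) where

      open Geodesic γ
      open GeodesicProperties γ

      joint : V
      joint = vertex d

      newPath : List V
      newPath = applyUpTo vertex d

      level : ∀ s → s ≤ d → Sphere (suc (d ∸ s)) (vertex s)
      level s s≤d = subst (λ k → Sphere k (vertex s)) (+-∸-assoc 1 s≤d) (on-sphere s (≤-trans s≤d (n≤1+n d)))

      new-free : ∀ s → s ≤ d → role (vertex s) ≡ nothing
      new-free s s≤d = non-member role (vertex s) (sphere-suc-∉A (d ∸ s) (vertex s) (level s s≤d))

      path-vertex-isolated : ∀ s → s < d → ∀ z → member role z ≡ true → adj G (vertex s) z ≡ true → ⊥
      path-vertex-isolated s s<d z z∈ sz =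
        sphere-2+-nonadjacent-A (d ∸ suc s) (vertex s) z
          (subst (λ k → Sphere (suc k) (vertex s)) (+-∸-assoc 1 s<d) (level s (<⇒≤ s<d)))
          z∈ (member⇒component z z∈) sz

      joint∉newPath : joint ∈ newPath → ⊥
      joint∉newPath h with s , s<d , e ← ∈-applyUpTo⁻ vertex h =
        <⇒≢ s<d (vertex-injective s d (≤-trans (<⇒≤ s<d) (n≤1+n d)) (n≤1+n d) (≡-sym e))

      newPath-free : ∀ y → y ∈ newPath → role y ≡ nothing
      newPath-free y h with s , s<d , refl ← ∈-applyUpTo⁻ vertex h = new-free s (<⇒≤ s<d)

      newRole : V → Maybe Role
      newRole x with x ≟ joint | x ∈? newPath
      ... | yes _ | _     = just junction
      ... | no  _ | yes _ = just (onPath newPath)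
      ... | no  _ | no  _ = nothing

      role′ : V → Maybe Role
      role′ x = role x <∣> newRole x

      role′-old : ∀ x k → role x ≡ just k → role′ x ≡ just k
      role′-old x k e rewrite e = refl

      role′-joint : role′ joint ≡ just junction
      role′-joint rewrite new-free d ≤-refl with joint ≟ joint
      ... | yes _ = refl
      ... | no  ≢ = ⊥-elim (≢ refl)

      role′-path : ∀ y → y ∈ newPath → role′ y ≡ just (onPath newPath)
      role′-path y h rewrite newPath-free y h with y ≟ joint | y ∈? newPath
      ... | yes refl | _     = ⊥-elim (joint∉newPath h)
      ... | no  _    | yes _ = refl
      ... | no  _    | no ∉  = ⊥-elim (∉ h)

      data Source : V → Role → Set where
        old       : ∀ {x k} → role x ≡ just k → Source x k
        new-joint : Source joint junction
        new-path  : ∀ {y} → y ∈ newPath → Source y (onPath newPath)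

      source : ∀ x k → role′ x ≡ just k → Source x k
      source x k e with <∣>-just⁻ (role x) (newRole x) e
      ... | inj₁ e′ = old e′
      ... | inj₂ (_ , e′) with x ≟ joint | x ∈? newPath
      source x k e | inj₂ (_ , refl) | yes refl | _     = new-joint
      source x k e | inj₂ (_ , refl) | no  _    | yes h = new-path h

      member′-old : ∀ x → member role x ≡ true → member role′ x ≡ true
      member′-old x x∈ with k , e ← member-elim role x x∈ = member-intro role′ x k (role′-old x k e)

      on-connector′ : ∀ s → s ≤ suc d → member role′ (vertex s) ≡ true
      on-connector′ s s≤ with m≤n⇒m<n∨m≡n s≤
      ... | inj₂ refl = member′-old _ end∈A
      ... | inj₁ (s≤s s≤d) with m≤n⇒m<n∨m≡n s≤d
      ...   | inj₂ refl = member-intro role′ _ _ role′-joint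
      ...   | inj₁ s<d  = member-intro role′ _ _ (role′-path _ (∈-applyUpTo⁺ vertex s<d))

      to-new : ∀ s → s ≤ suc d → Star (EdgeIn G (λ z → member role′ z ≡ true)) root (vertex s)
      to-new s s≤ with k , e ← member-elim role _ end∈A =
        walk-mono member′-old (reachable _ k e) ◅◅ walk-from-end (λ z → member role′ z ≡ true) on-connector′ s s≤

      in-component : ∀ s → s ≤ suc d → component (vertex s) ≡ true
      in-component s s≤ = sphere⊆W _ _ (on-sphere s s≤)

      path-induced′ : ∀ x L → role′ x ≡ just (onPath L) → InducedPath L × (∀ y → (y ∈ L) ⇔ (role′ y ≡ just (onPath L)))
      path-induced′ x L e with source x _ e
      ... | old e′ = proj₁ (path-induced x L e′) , λ y → mk⇔ (λ h → role′-old y _ (Equivalence.to (members y) h)) (back y)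
        where
        members = proj₂ (path-induced x L e′)
        back : ∀ y → role′ y ≡ just (onPath L) → y ∈ L
        back y e″ with source y _ e″
        ... | old e‴   = Equivalence.from (members y) e‴
        ... | new-path _ with () ← trans (≡-sym e′) (newPath-free x (Equivalence.from (members x) e′))
      ... | new-path _ = prefix-inducedPath d (≤-trans (n≤1+n d) (n≤1+n (suc d))) , λ y → mk⇔ (role′-path y) (back y)
        where
        back : ∀ y → role′ y ≡ just (onPath newPath) → y ∈ newPath
        back y e″ with source y _ e″
        ... | new-path h = h
        ... | old e‴ with () ← trans (≡-sym e‴) (newPath-free y (Equivalence.from (proj₂ (path-induced y newPath e‴) y) e‴))

      paths-apart′ : ∀ x y L L′ → adj G x y ≡ true → role′ x ≡ just (onPath L) → role′ y ≡ just (onPath L′) → L ≡ L′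
      paths-apart′ x y L L′ xy ex ey with source x _ ex | source y _ ey
      ... | old ex′    | old ey′    = paths-apart x y L L′ xy ex′ ey′
      ... | new-path _ | new-path _ = refl
      ... | old ex′    | new-path h with s , s<d , refl ← ∈-applyUpTo⁻ vertex h =
        ⊥-elim (path-vertex-isolated s s<d x (member-intro role x _ ex′) (adj-sym xy))
      ... | new-path h | old ey′ with s , s<d , refl ← ∈-applyUpTo⁻ vertex h =
        ⊥-elim (path-vertex-isolated s s<d y (member-intro role y _ ey′) xy)

      grown : Connector (a ∷ done) (suc bound)
      grown = record
        { role = role′ ; junctions = joint ∷ junctions ; root = root ; root∈ = member′-old root root∈
        ; ⊆component = λ x k e → case source x k e of λ
            { (old e′) → ⊆component x k e′
            ; new-joint → in-component d (n≤1+n d)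
            ; (new-path h) → let s , s<d , x≡ = ∈-applyUpTo⁻ vertex h in
                             subst (λ z → component z ≡ true) (≡-sym x≡) (in-component s (≤-trans (<⇒≤ s<d) (n≤1+n d))) }
        ; reachable = λ x k e → case source x k e of λ
            { (old e′) → walk-mono member′-old (reachable x k e′)
            ; new-joint → to-new d (n≤1+n d)
            ; (new-path h) → let s , s<d , x≡ = ∈-applyUpTo⁻ vertex h in
                             subst (Star _ root) (≡-sym x≡) (to-new s (≤-trans (<⇒≤ s<d) (n≤1+n d))) }
        ; junction⇒∈ = λ x e → case source x junction e of λ { (old e′) → there (junction⇒∈ x e′) ; new-joint → here refl }
        ; ∈⇒junction = λ { x (here refl) → role′-joint ; x (there h) → role′-old x junction (∈⇒junction x h) }
        ; #junctions = s≤s #junctions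
        ; path-induced = path-induced′
        ; paths-apart = paths-apart′
        ; reaches-done = λ { b (here refl) → reaches role′ a (vertex 0) (on-connector′ 0 z≤n) touches
                           ; b (there h) → let x , y , x∈ , xy , yb = reaches-done b h in x , y , member′-old x x∈ , xy , yb } }

    from-geodesic : (∃ λ d → Σ (Geodesic d) λ γ → touchesPair a (Geodesic.vertex γ 0) ≡ true) → Connector (a ∷ done) (suc bound)
    from-geodesic (suc d , γ , touches) = Grow.grown d γ touches
    from-geodesic (zero  , γ , touches) =
      widen T (λ { b (here refl) → reaches role a (vertex 0) (∧-elimˡ (on-sphere 0 z≤n)) touches
                 ; b (there h) → reaches-done b h })
            (n≤1+n bound)
      where open Geodesic γ

    extended : Connector (a ∷ done) (suc bound)
    extended = from-geodesic (shortest-geodesic (touchesPair a) (proj₁ reached) (inner c) (proj₂ reached) (inner-touches c))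
      where
      c : Contact a
      c = contact a seen
      root∈component : component root ≡ true
      root∈component = member⇒component root root∈
      reached : ∃ λ k → ball k (inner c) ≡ true
      reached = walk⇒ball root (inner c) root∈ root∈component (component-connected root (inner c) root∈component (inner∈ c))

  -- The first two seen colour pairs are joined by a single shortest path, with no junction.
  module Start (v : V) (v∈ : component v ≡ true) (a₁ : Fin K) (v-touches : touchesPair a₁ v ≡ true)
               (a₂ : Fin K) (seen₂ : pairSeen a₂ ≡ true) where

    open Layers G component (λ x → does (x ≟ v))

    from-geodesic : (∃ λ d → Σ (Geodesic d) λ γ → touchesPair a₂ (Geodesic.vertex γ 0) ≡ true) → Connector (a₂ ∷ a₁ ∷ []) 0
    from-geodesic (d , γ , touches) =
      OnePath.connector (a₂ ∷ a₁ ∷ []) (applyUpTo vertex (suc d)) (vertex d) (∈-applyUpTo⁺ vertex ≤-refl)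
                        (prefix-inducedPath (suc d) ≤-refl) on-path⊆component touch
      where
      open Geodesic γ
      open GeodesicProperties γ
      on-path⊆component : ∀ x → x ∈ applyUpTo vertex (suc d) → component x ≡ true
      on-path⊆component x h with s , s<1+d , refl ← ∈-applyUpTo⁻ vertex h = sphere⊆W _ _ (on-sphere s (≤-pred s<1+d))
      touch : ∀ a → a ∈ a₂ ∷ a₁ ∷ [] → ∃ λ x → x ∈ applyUpTo vertex (suc d) × touchesPair a x ≡ true
      touch a (here refl)         = vertex 0 , ∈-applyUpTo⁺ vertex (s≤s z≤n) , touches
      touch a (there (here refl)) = vertex d , ∈-applyUpTo⁺ vertex ≤-refl
                                  , subst (λ x → touchesPair a₁ x ≡ true) (≡-sym (does-true⇒ (vertex d ≟ v) end∈A)) v-touches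

    connector : Connector (a₂ ∷ a₁ ∷ []) 0
    connector = from-geodesic (shortest-geodesic (touchesPair a₂) (proj₁ reached) (inner c) (proj₂ reached) (inner-touches c))
      where
      c : Contact a₂
      c = contact a₂ seen₂
      reached : ∃ λ k → ball k (inner c) ≡ true
      reached = walk⇒ball v (inner c) (dec-true (v ≟ v) refl) v∈ (component-connected v (inner c) v∈ (inner∈ c))

  extend-all : ∀ {done bound} → Connector done bound → (pairs : List (Fin K)) → All (λ a → pairSeen a ≡ true) pairs →
               Connector (pairs ++ done) (length pairs + bound)
  extend-all T []             []             = T
  extend-all {done} {bound} T (a ∷ pairs) (seen ∷ seens) =
    relax (extend-all (Extend.extended T a seen) pairs seens) move (≤-reflexive (+-suc (length pairs) bound))
    where
    move : ∀ b → b ∈ a ∷ pairs ++ done → b ∈ pairs ++ a ∷ done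
    move b (here refl) = ∈-++⁺ʳ pairs (here refl)
    move b (there h) with ∈-++⁻ pairs h
    ... | inj₁ h′ = ∈-++⁺ˡ h′
    ... | inj₂ h′ = ∈-++⁺ʳ pairs (there h′)

  -- At most K − 1 = m + 2 pairs are seen: two are joined by Start, each further one costs a junction.
  connector-for : ∀ pairs → length pairs ≤ suc (suc m) → All (λ a → pairSeen a ≡ true) pairs → Connector pairs m
  connector-for [] _ _ = singleton [] u u∈component λ _ ()
  connector-for (a₁ ∷ []) _ (seen₁ ∷ []) =
    singleton (a₁ ∷ []) (inner c) (inner∈ c) λ { _ (here refl) → inner-touches c }
    where c = contact a₁ seen₁
  connector-for (a₁ ∷ a₂ ∷ rest) (s≤s (s≤s len)) (seen₁ ∷ seen₂ ∷ seens) =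
    relax (extend-all (Start.connector (inner c) (inner∈ c) a₁ (inner-touches c) a₂ seen₂) rest seens) move
          (≤-trans (≤-reflexive (+-identityʳ (length rest))) len)
    where
    c = contact a₁ seen₁
    move : ∀ b → b ∈ a₁ ∷ a₂ ∷ rest → b ∈ rest ++ a₂ ∷ a₁ ∷ []
    move b (here refl)         = ∈-++⁺ʳ rest (there (here refl))
    move b (there (here refl)) = ∈-++⁺ʳ rest (here refl)
    move b (there (there h))   = ∈-++⁺ˡ h

module NewBag (G : Graph) (m : ℕ) (st : State.PartialColouring G m) (#bags : ℕ) (inv : State.Invariant G m st #bags)
              (u : Fin (n G)) (u-free : st u ≡ nothing) (a₀ : Fin (State.K G m))
              (unseen : Contacts.pairSeen G m st u u-free a₀ ≡ false)
              (pairs : List (Fin (State.K G m))) (pairs-complete : ∀ a → Contacts.pairSeen G m st u u-free a ≡ true → a ∈ pairs)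
              (T : Connectors.Connector G m st u u-free pairs m) where

  open State G m
  open Invariant inv
  open Component G m st u u-free using (component; component⇒free; component⇒InComponent; InComponent⇒component)
  open Contacts G m st u u-free using (pairSeen; pairSeen-intro)
  open Connectors G m st u u-free using (Role; junction; onPath; member; member-intro; member-elim; Reaches)
  open Connectors.Connector T

  asPiece : Maybe Role → Maybe (ℕ × Piece) → Maybe (ℕ × Piece)
  asPiece (just junction)   _   = just (#bags , small a₀ junctions)
  asPiece (just (onPath L)) _   = just (#bags , path a₀ L)
  asPiece nothing           old = old

  st′ : PartialColouring
  st′ x = asPiece (role x) (st x)

  role⇒free : ∀ x k → role x ≡ just k → st x ≡ nothing
  role⇒free x k e = component⇒free x (⊆component x k e)

  coloured⇒no-role : ∀ x i → st x ≡ just i → role x ≡ nothing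
  coloured⇒no-role x i e with role x in r
  ... | nothing = refl
  ... | just k with () ← trans (≡-sym e) (role⇒free x k r)

  st′-old : ∀ x i → st x ≡ just i → st′ x ≡ just i
  st′-old x i e rewrite coloured⇒no-role x i e = e

  member⇒new-bag : ∀ x → member role x ≡ true → InBag st′ #bags x
  member⇒new-bag x x∈ with role x | member-elim role x x∈
  ... | just junction   | _ = small a₀ junctions , refl
  ... | just (onPath L) | _ = path a₀ L , refl

  data Entry (x : V) : ℕ → Piece → Set where
    old          : ∀ {b p} → role x ≡ nothing → st x ≡ just (b , p) → Entry x b p
    new-junction : role x ≡ just junction → Entry x #bags (small a₀ junctions)
    new-path     : ∀ L → role x ≡ just (onPath L) → Entry x #bags (path a₀ L)

  entry : ∀ x b p → st′ x ≡ just (b , p) → Entry x b p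
  entry x b p e with role x in r
  ... | nothing              = old r e
  entry x b p refl | just junction   = new-junction r
  entry x b p refl | just (onPath L) = new-path L r

  new⇒member : ∀ {x p} → Entry x #bags p → st x ≡ nothing → member role x ≡ true
  new⇒member (old _ e)        x-free with () ← trans (≡-sym e) x-free
  new⇒member (new-junction e) _      = member-intro role _ _ e
  new⇒member (new-path L e)   _      = member-intro role _ _ e

  old-bag<cN : ∀ x p → st x ≡ just (#bags , p) → ⊥
  old-bag<cN x p e = <-irrefl refl (bag< x #bags p e)

  free′⇒free : ∀ x → st′ x ≡ nothing → st x ≡ nothing
  free′⇒free x e = by-cases (st x) refl
    where
    by-cases : ∀ o → st x ≡ o → st x ≡ nothing
    by-cases nothing  sx = sx
    by-cases (just i) sx with () ← trans (≡-sym (st′-old x i sx)) e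

  lift-InBag : ∀ b z → InBag st b z → InBag st′ b z
  lift-InBag b z (p , e) = p , st′-old z _ e

  lift-InComponent : ∀ u′ x → InComponent st′ u′ x → InComponent st u′ x
  lift-InComponent u′ x (u′-free , x-free , walk) = free′⇒free u′ u′-free , free′⇒free x x-free , walk-mono free′⇒free walk

  neighbour-pair≢a₀ : ∀ x y b p → member role x ≡ true → st y ≡ just (b , p) → adj G x y ≡ true → colourPair p ≢ a₀
  neighbour-pair≢a₀ x y b p x∈ e xy pair≡a₀ with k , r ← member-elim role x x∈ =
    not-¬ (pairSeen-intro a₀ y x (hasPair-intro st a₀ y b p e pair≡a₀) (⊆component x k r) xy) unseen

  private
    bag<′ : ∀ x b p → st′ x ≡ just (b , p) → b < suc #bags
    bag<′ x b p e with entry x b p e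
    ... | old _ e′         = ≤-trans (bag< x b p e′) (n≤1+n #bags)
    ... | new-junction _   = ≤-refl
    ... | new-path _ _     = ≤-refl

    monochromatic-edge′ : ∀ x y b p p′ → st′ x ≡ just (b , p) → st′ y ≡ just (b , p′) → adj G x y ≡ true →
                          colour p ≡ colour p′ → p ≡ p′
    monochromatic-edge′ x y b p p′ ex ey xy same with entry x b p ex | entry y b p′ ey
    ... | old _ ex′        | old _ ey′        = monochromatic-edge x y b p p′ ex′ ey′ xy same
    ... | old _ ex′        | new-junction _   = ⊥-elim (old-bag<cN x p ex′)
    ... | old _ ex′        | new-path _ _     = ⊥-elim (old-bag<cN x p ex′)
    ... | new-junction _   | old _ ey′        = ⊥-elim (old-bag<cN y p′ ey′)
    ... | new-path _ _     | old _ ey′        = ⊥-elim (old-bag<cN y p′ ey′)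
    ... | new-junction _   | new-junction _   = refl
    ... | new-path L ex′   | new-path L′ ey′  = cong (path a₀) (paths-apart x y L L′ xy ex′ ey′)

    small-piece′ : ∀ x b a L → st′ x ≡ just (b , small a L) →
                   length L ≤ m × (∀ y b′ → st′ y ≡ just (b′ , small a L) → y ∈ L)
    small-piece′ x b a L e with entry x b (small a L) e
    ... | new-junction _ = #junctions , back
      where
      back : ∀ y b′ → st′ y ≡ just (b′ , small a₀ junctions) → y ∈ junctions
      back y b′ ey with entry y b′ _ ey
      ... | new-junction ey′ = junction⇒∈ y ey′
      ... | old ry ey′ with () ← trans (≡-sym (∈⇒junction y (proj₂ (small-piece y b′ a₀ junctions ey′) y b′ ey′))) ry
    ... | old rx ex′ = proj₁ (small-piece x b a L ex′) , back
      where
      back : ∀ y b′ → st′ y ≡ just (b′ , small a L) → y ∈ L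
      back y b′ ey with entry y b′ _ ey
      ... | old _ ey′        = proj₂ (small-piece x b a L ex′) y b′ ey′
      ... | new-junction _ with () ← trans (≡-sym (∈⇒junction x (proj₂ (small-piece x b a L ex′) x b ex′))) rx

    path-piece′ : ∀ x b a L → st′ x ≡ just (b , path a L) →
                  InducedPath L × (∀ y → (y ∈ L) ⇔ (∃ λ b′ → st′ y ≡ just (b′ , path a L)))
    path-piece′ x b a L e with entry x b (path a L) e
    ... | new-path L ex′ = proj₁ (path-induced x L ex′) , λ y → mk⇔ (to y) (from y)
      where
      members = proj₂ (path-induced x L ex′)
      to : ∀ y → y ∈ L → ∃ λ b′ → st′ y ≡ just (b′ , path a₀ L)
      to y y∈L rewrite Equivalence.to (members y) y∈L = #bags , refl
      from : ∀ y → (∃ λ b′ → st′ y ≡ just (b′ , path a₀ L)) → y ∈ L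
      from y (b′ , ey) with entry y b′ _ ey
      ... | new-path L ey′ = Equivalence.from (members y) ey′
      ... | old ry ey′ with () ← trans (≡-sym (Equivalence.to (members y)
                                    (Equivalence.from (proj₂ (path-piece y b′ a₀ L ey′) y) (b′ , ey′)))) ry
    ... | old rx ex′ = proj₁ (path-piece x b a L ex′) , λ y → mk⇔ (to y) (from y)
      where
      members = proj₂ (path-piece x b a L ex′)
      to : ∀ y → y ∈ L → ∃ λ b′ → st′ y ≡ just (b′ , path a L)
      to y y∈L with b′ , ey ← Equivalence.to (members y) y∈L = b′ , st′-old y _ ey
      from : ∀ y → (∃ λ b′ → st′ y ≡ just (b′ , path a L)) → y ∈ L
      from y (b′ , ey) with entry y b′ _ ey
      ... | old _ ey′ = Equivalence.from (members y) (b′ , ey′)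
      ... | new-path L ey′ with () ← trans (≡-sym (Equivalence.to (proj₂ (path-induced y L ey′) x)
                                       (Equivalence.from (members x) (b , ex′)))) rx

    new-bag-connected : ∀ {x y p p′} → Entry x #bags p → Entry y #bags p′ → Star (EdgeIn G (InBag st′ #bags)) x y
    new-bag-connected nx ny = walk-mono member⇒new-bag (walk-reverse (from-root nx) ◅◅ from-root ny)
      where
      from-root : ∀ {z q} → Entry z #bags q → Star (EdgeIn G (λ w → member role w ≡ true)) root z
      from-root (old _ e)        = ⊥-elim (old-bag<cN _ _ e)
      from-root (new-junction e) = reachable _ _ e
      from-root (new-path L e)   = reachable _ _ e

    bag-connected′ : ∀ x y b p p′ → st′ x ≡ just (b , p) → st′ y ≡ just (b , p′) → ConnIn G (InBag st′ b) x y
    bag-connected′ x y b p p′ ex ey with entry x b p ex | entry y b p′ ey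
    ... | old _ ex′ | old _ ey′ = (p , ex) , (p′ , ey) , walk-mono (lift-InBag b) (proj₂ (proj₂ (bag-connected x y b p p′ ex′ ey′)))
    ... | old _ ex′ | new-junction _ = ⊥-elim (old-bag<cN x p ex′)
    ... | old _ ex′ | new-path _ _   = ⊥-elim (old-bag<cN x p ex′)
    ... | new-junction _ | old _ ey′ = ⊥-elim (old-bag<cN y p′ ey′)
    ... | new-path _ _   | old _ ey′ = ⊥-elim (old-bag<cN y p′ ey′)
    ... | nx@(new-junction _) | ny@(new-junction _) = (p , ex) , (p′ , ey) , new-bag-connected nx ny
    ... | nx@(new-junction _) | ny@(new-path _ _)   = (p , ex) , (p′ , ey) , new-bag-connected nx ny
    ... | nx@(new-path _ _)   | ny@(new-junction _) = (p , ex) , (p′ , ey) , new-bag-connected nx ny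
    ... | nx@(new-path _ _)   | ny@(new-path _ _)   = (p , ex) , (p′ , ey) , new-bag-connected nx ny

    touching-bags-differ′ : ∀ x y b b′ p p′ → st′ x ≡ just (b , p) → st′ y ≡ just (b′ , p′) → adj G x y ≡ true →
                            b ≢ b′ → colourPair p ≢ colourPair p′
    touching-bags-differ′ x y b b′ p p′ ex ey xy b≢b′ with entry x b p ex | entry y b′ p′ ey
    ... | old _ ex′ | old _ ey′ = touching-bags-differ x y b b′ p p′ ex′ ey′ xy b≢b′
    ... | old _ ex′ | new-junction r = neighbour-pair≢a₀ y x b p (member-intro role y _ r) ex′ (adj-sym xy)
    ... | old _ ex′ | new-path _ r   = neighbour-pair≢a₀ y x b p (member-intro role y _ r) ex′ (adj-sym xy)
    ... | new-junction r | old _ ey′ = neighbour-pair≢a₀ x y b′ p′ (member-intro role x _ r) ey′ xy ∘ ≡-sym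
    ... | new-path _ r   | old _ ey′ = neighbour-pair≢a₀ x y b′ p′ (member-intro role x _ r) ey′ xy ∘ ≡-sym
    ... | new-junction _ | new-junction _ = ⊥-elim (b≢b′ refl)
    ... | new-junction _ | new-path _ _   = ⊥-elim (b≢b′ refl)
    ... | new-path _ _   | new-junction _ = ⊥-elim (b≢b′ refl)
    ... | new-path _ _   | new-path _ _   = ⊥-elim (b≢b′ refl)

    bag-colourPair′ : ∀ x y b p p′ → st′ x ≡ just (b , p) → st′ y ≡ just (b , p′) → colourPair p ≡ colourPair p′
    bag-colourPair′ x y b p p′ ex ey with entry x b p ex | entry y b p′ ey
    ... | old _ ex′      | old _ ey′      = bag-colourPair x y b p p′ ex′ ey′
    ... | old _ ex′      | new-junction _ = ⊥-elim (old-bag<cN x p ex′)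
    ... | old _ ex′      | new-path _ _   = ⊥-elim (old-bag<cN x p ex′)
    ... | new-junction _ | old _ ey′      = ⊥-elim (old-bag<cN y p′ ey′)
    ... | new-path _ _   | old _ ey′      = ⊥-elim (old-bag<cN y p′ ey′)
    ... | new-junction _ | new-junction _ = refl
    ... | new-junction _ | new-path _ _   = refl
    ... | new-path _ _   | new-junction _ = refl
    ... | new-path _ _   | new-path _ _   = refl

    -- The connector reaches the colour pair of every bag seen from the component, and by the
    -- invariant the vertex it reaches lies in that very bag: another bag with the same pair
    -- would touch it.
    connector-touches-bag : ∀ x y b p → component x ≡ true → st y ≡ just (b , p) → adj G x y ≡ true →
                            ∃₂ λ x′ y′ → member role x′ ≡ true × adj G x′ y′ ≡ true × InBag st b y′
    connector-touches-bag x y b p x∈ yp xy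
      with x′ , y′ , x′∈ , x′y′ , y′-pair ←
             reaches-done (colourPair p) (pairs-complete _ (pairSeen-intro _ y x (hasPair-intro st _ y b p yp refl) x∈ xy))
      with b′ , p″ , y′p″ , same-pair ← hasPair-elim st (colourPair p) y′ y′-pair
      with b′ ≟ℕ b
    ... | yes refl = x′ , y′ , x′∈ , x′y′ , (p″ , y′p″)
    ... | no b′≢b
      with k , r ← member-elim role x′ x′∈
      with z₁ , z₂ , (q₁ , z₁q₁) , (q₂ , z₂q₂) , z₁z₂ ←
             bags-around-component-touch u x′ x y′ y b′ b p″ p u-free
               (component⇒InComponent x′ (⊆component x′ k r)) (component⇒InComponent x x∈) x′y′ xy y′p″ yp b′≢b
      = ⊥-elim (touching-bags-differ z₁ z₂ b′ b q₁ q₂ z₁q₁ z₂q₂ z₁z₂ b′≢b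
                  (trans (bag-colourPair z₁ y′ b′ q₁ p″ z₁q₁ y′p″) (trans same-pair (≡-sym (bag-colourPair z₂ y b q₂ p z₂q₂ yp)))))

    next-to-connector⇒inside : ∀ u′ x₁ y₁ x₂ → InComponent st′ u′ x₁ → adj G x₁ y₁ ≡ true → member role y₁ ≡ true →
                               InComponent st′ u′ x₂ → component x₂ ≡ true
    next-to-connector⇒inside u′ x₁ y₁ x₂ c₁ x₁y₁ y₁∈ c₂
      with k , r ← member-elim role y₁ y₁∈
      with _ , y₁-free , u-y₁ ← component⇒InComponent y₁ (⊆component y₁ k r)
      with _ , x₁-free , u′-x₁ ← lift-InComponent u′ x₁ c₁
      with _ , x₂-free , u′-x₂ ← lift-InComponent u′ x₂ c₂
      = InComponent⇒component x₂ (u-free , x₂-free , u-y₁ ◅◅ walk-reverse (u′-x₁ ◅◅ ((x₁-free , y₁-free , x₁y₁) ◅ ε)) ◅◅ u′-x₂)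

    new-touches-old : ∀ u′ x₁ x₂ y₁ y₂ b₂ p₂ → InComponent st′ u′ x₁ → InComponent st′ u′ x₂ →
                      adj G x₁ y₁ ≡ true → adj G x₂ y₂ ≡ true → member role y₁ ≡ true → st y₂ ≡ just (b₂ , p₂) →
                      BagsTouch st′ #bags b₂
    new-touches-old u′ x₁ x₂ y₁ y₂ b₂ p₂ c₁ c₂ x₁y₁ x₂y₂ y₁∈ e₂
      with x′ , y′ , x′∈ , x′y′ , i ←
             connector-touches-bag x₂ y₂ b₂ p₂ (next-to-connector⇒inside u′ x₁ y₁ x₂ c₁ x₁y₁ y₁∈ c₂) e₂ x₂y₂
      = x′ , y′ , member⇒new-bag x′ x′∈ , lift-InBag b₂ y′ i , x′y′

    BagsTouch-sym : ∀ {b₁ b₂} → BagsTouch st′ b₁ b₂ → BagsTouch st′ b₂ b₁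
    BagsTouch-sym (z₁ , z₂ , i₁ , i₂ , z₁z₂) = z₂ , z₁ , i₂ , i₁ , adj-sym z₁z₂

    bags-around-component-touch′ :
      ∀ u′ x₁ x₂ y₁ y₂ b₁ b₂ p₁ p₂ → st′ u′ ≡ nothing → InComponent st′ u′ x₁ → InComponent st′ u′ x₂ →
      adj G x₁ y₁ ≡ true → adj G x₂ y₂ ≡ true → st′ y₁ ≡ just (b₁ , p₁) → st′ y₂ ≡ just (b₂ , p₂) →
      b₁ ≢ b₂ → BagsTouch st′ b₁ b₂
    bags-around-component-touch′ u′ x₁ x₂ y₁ y₂ b₁ b₂ p₁ p₂ u′-free c₁ c₂ x₁y₁ x₂y₂ e₁ e₂ b₁≢b₂
      with entry y₁ b₁ p₁ e₁ | entry y₂ b₂ p₂ e₂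
    ... | old _ e₁′ | old _ e₂′
      with z₁ , z₂ , i₁ , i₂ , z₁z₂ ←
             bags-around-component-touch u′ x₁ x₂ y₁ y₂ b₁ b₂ p₁ p₂ (free′⇒free u′ u′-free)
               (lift-InComponent u′ x₁ c₁) (lift-InComponent u′ x₂ c₂) x₁y₁ x₂y₂ e₁′ e₂′ b₁≢b₂
      = z₁ , z₂ , lift-InBag b₁ z₁ i₁ , lift-InBag b₂ z₂ i₂ , z₁z₂
    ... | new-junction r | old _ e₂′ = new-touches-old u′ x₁ x₂ y₁ y₂ b₂ p₂ c₁ c₂ x₁y₁ x₂y₂ (member-intro role y₁ _ r) e₂′
    ... | new-path _ r   | old _ e₂′ = new-touches-old u′ x₁ x₂ y₁ y₂ b₂ p₂ c₁ c₂ x₁y₁ x₂y₂ (member-intro role y₁ _ r) e₂′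
    ... | old _ e₁′ | new-junction r =
      BagsTouch-sym (new-touches-old u′ x₂ x₁ y₂ y₁ b₁ p₁ c₂ c₁ x₂y₂ x₁y₁ (member-intro role y₂ _ r) e₁′)
    ... | old _ e₁′ | new-path _ r =
      BagsTouch-sym (new-touches-old u′ x₂ x₁ y₂ y₁ b₁ p₁ c₂ c₁ x₂y₂ x₁y₁ (member-intro role y₂ _ r) e₁′)
    ... | new-junction _ | new-junction _ = ⊥-elim (b₁≢b₂ refl)
    ... | new-junction _ | new-path _ _   = ⊥-elim (b₁≢b₂ refl)
    ... | new-path _ _   | new-junction _ = ⊥-elim (b₁≢b₂ refl)
    ... | new-path _ _   | new-path _ _   = ⊥-elim (b₁≢b₂ refl)

  invariant′ : Invariant st′ (suc #bags)
  invariant′ = record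
    { bag< = bag<′ ; monochromatic-edge = monochromatic-edge′ ; small-piece = small-piece′ ; path-piece = path-piece′
    ; bag-connected = bag-connected′ ; bags-around-component-touch = bags-around-component-touch′
    ; touching-bags-differ = touching-bags-differ′ ; bag-colourPair = bag-colourPair′ }

  fewer-uncoloured : count (uncoloured st′) < count (uncoloured st)
  fewer-uncoloured with k , r ← member-elim role root root∈ =
    count-mono-< (uncoloured st′) (uncoloured st)
      (λ x e → nothing⇒uncoloured st x (free′⇒free x (uncoloured⇒nothing st′ x e)))
      root (nothing⇒uncoloured st root (role⇒free root k r)) (coloured′ (proj₂ (member⇒new-bag root root∈)))
    where
    coloured′ : ∀ {p} → st′ root ≡ just (#bags , p) → uncoloured st′ root ≡ false
    coloured′ e rewrite e = refl

module Step (G : Graph) (m : ℕ) (st : State.PartialColouring G m) (#bags : ℕ) (inv : State.Invariant G m st #bags)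
            (u : Fin (n G)) (u-free : st u ≡ nothing) (no-minor : ¬ HasKMinor (suc (State.K G m)) G) where

  open State G m
  open Contacts G m st u u-free using (pairSeen)

  Progress : Set
  Progress = Σ PartialColouring λ st′ → Invariant st′ (suc #bags) × count (uncoloured st′) < count (uncoloured st)

  seen? : ∀ a → Dec (pairSeen a ≡ true)
  seen? a = pairSeen a ≟ᵇ true

  module Unseen (a₀ : Fin K) (unseen : pairSeen a₀ ≡ false) where

    seenPairs : List (Fin K)
    seenPairs = filter seen? (allFin K)

    #seenPairs : length seenPairs ≤ suc (suc m)
    #seenPairs = ≤-pred (subst (suc (length seenPairs) ≤_) (length-tabulate (λ a → a))
                   (filter-notAll seen? (allFin K) (Any.map (λ { refl seen → not-¬ seen unseen }) (∈-allFin a₀))))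

    open NewBag G m st #bags inv u u-free a₀ unseen seenPairs (λ a seen → ∈-filter⁺ seen? (∈-allFin a) seen)
                (Connectors.connector-for G m st u u-free seenPairs #seenPairs
                   (All.tabulate λ a∈ → proj₂ (∈-filter⁻ seen? a∈)))

    progress : Progress
    progress = st′ , invariant′ , fewer-uncoloured

  progress : Progress
  progress with all? seen?
  ... | yes all-seen = ⊥-elim (no-minor (Minor.AllPairsSeen.minor G m st #bags inv u u-free all-seen))
  ... | no ¬all-seen with a₀ , unseen ← ¬∀⟶∃¬ K _ seen? ¬all-seen = Unseen.progress a₀ (¬-not unseen)

module Colouring (G : Graph) (m : ℕ) (no-minor : ¬ HasKMinor (suc (State.K G m)) G) where

  open State G m

  Complete : Set
  Complete = Σ PartialColouring λ st → Σ ℕ λ #bags → Invariant st #bags × (∀ x → ∃ λ i → st x ≡ just i)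

  complete : ∀ st #bags → Invariant st #bags → Acc _<_ (count (uncoloured st)) → Complete
  complete st #bags inv (acc fewer⇒acc) with any?ᵇ (uncoloured st)
  ... | no none = st , #bags , inv , coloured
    where
    coloured : ∀ x → ∃ λ i → st x ≡ just i
    coloured x with st x in e
    ... | just i  = i , refl
    ... | nothing = ⊥-elim (none (x , nothing⇒uncoloured st x e))
  ... | yes (u , u-unc) with st′ , inv′ , fewer ← Step.progress G m st #bags inv u (uncoloured⇒nothing st u u-unc) no-minor =
    complete st′ (suc #bags) inv′ (fewer⇒acc fewer)

  final : Complete
  final = complete (λ _ → nothing) 0 empty-invariant (<-wellFounded _)

  module ReadOff (stF : PartialColouring) (#bags : ℕ) (inv : Invariant stF #bags) (coloured : ∀ x → ∃ λ i → stF x ≡ just i) where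

    open Invariant inv

    bagOf : V → ℕ
    bagOf x = proj₁ (proj₁ (coloured x))

    piece : V → Piece
    piece x = proj₂ (proj₁ (coloured x))

    stF-piece : ∀ x {p} → piece x ≡ p → stF x ≡ just (bagOf x , p)
    stF-piece x refl = proj₂ (coloured x)

    monochromatic-edgeF : ∀ x y → adj G x y ≡ true → colour (piece x) ≡ colour (piece y) → piece x ≡ piece y
    monochromatic-edgeF x y xy same with bagOf x ≟ℕ bagOf y
    ... | yes b≡ = monochromatic-edge x y (bagOf x) (piece x) (piece y) (stF-piece x refl)
                     (subst (λ b → stF y ≡ just (b , piece y)) (≡-sym b≡) (stF-piece y refl)) xy same
    ... | no  b≢ = ⊥-elim (touching-bags-differ x y _ _ _ _ (stF-piece x refl) (stF-piece y refl) xy b≢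
                             (colour⇒colourPair _ _ same))

    small-pieceF : ∀ x a L → piece x ≡ small a L → length L ≤ m × (∀ y → piece y ≡ small a L → y ∈ L)
    small-pieceF x a L e = proj₁ sp , λ y e′ → proj₂ sp y _ (stF-piece y e′)
      where sp = small-piece x _ a L (stF-piece x e)

    path-pieceF : ∀ x a L → piece x ≡ path a L → InducedPath L × (∀ y → (y ∈ L) ⇔ (piece y ≡ path a L))
    path-pieceF x a L e = proj₁ pp , λ y → mk⇔ (to y) (λ e′ → Equivalence.from (proj₂ pp y) (_ , stF-piece y e′))
      where
      pp = path-piece x _ a L (stF-piece x e)
      to : ∀ y → y ∈ L → piece y ≡ path a L
      to y y∈L with b , e′ ← Equivalence.to (proj₂ pp y) y∈L =
        cong proj₂ (just-injective (trans (≡-sym (stF-piece y refl)) e′))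

    open FromPieces {m} piece monochromatic-edgeF small-pieceF path-pieceF public

  open ReadOff (proj₁ final) (proj₁ (proj₂ final)) (proj₁ (proj₂ (proj₂ final))) (proj₂ (proj₂ (proj₂ final))) public

theorem12 : (t : ℕ) → 4 ≤ t → (G : Graph) → ¬ HasKMinor t G →
    Σ (Fin (n G) → Fin (t ∸ 1) ⊎ Fin (t ∸ 1)) λ c →
      (∀ a → SmallComponents G c (inj₁ a) (t ∸ 4))
      × (∀ a → PathComponents G c (inj₂ a))
theorem12 .(suc (suc (suc (suc m)))) (s≤s (s≤s (s≤s (s≤s (z≤n {m}))))) G no-minor =
  colouring , small-components , path-components
  where open Colouring G m no-minor
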